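{- Let $\mathcal E$ be a compatible set of $n$-cbc such that $\mathcal E^\circ$ is bordered by $(P,Q)$. For any $X\in\mathcal E$, any integer $d_1$ coprime to $|Q|$ and any integer $d_2$ coprime to $|P|$, the set $\{\varphi_{d_1,d_2}(X)\}\cup\mathcal E$, where $$\varphi_{d_1,d_2}(X)=\{a^{(d_1i)\bmod n}\,b\,a^{(d_2j)\bmod n}: a^iba^j\in X\},$$ is a compatible set of $n$-cbc and its stable is bordered by $(P,Q)$.
   Context: Fix an alphabet $\mathcal A$ containing distinct letters $a,b$. A code is a set $X\subseteq\mathcal A^*$ such that $x_1\cdots x_t=y_1\cdots y_{t'}$ with $x_i,y_i\in X$ implies $t=t'$ and $x_i=y_i$ for all $i$. Write $[n]=\{0,\dots,n-1\}$, $u\bmod n$ for the remainder in $[n]$, $a^U=\{a^u:u\in U\}$. An $n$-cbc is a set $X\subseteq a^{[n]}ba^{[n]}$ with $|X|=n$ such that $\{a^n\}\cup X$ is a code. For $n$-cbc $X,Y$ and $r\in[n]$, $X\circ_rY=\{a^iba^\ell: a^iba^j\in X, a^kba^\ell\in Y, (j+k)\bmod n=r\}$ (associative). A set $\mathcal E$ of $n$-cbc is compatible if every composition $X_1\circ_{r_1}\cdots\circ_{r_k}X_{k+1}$ ($X_i\in\mathcal E$, $r_i\in[n]$) is an $n$-cbc; a set $\mathcal S$ of $n$-cbc is stable if $X\circ_rY\in\mathcal S$ for all $X,Y\in\mathcal S$, $r\in[n]$; for compatible $\mathcal E$, its stable $\mathcal E^\circ$ is the smallest stable set containing $\mathcal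 E$. For $X\subseteq\mathcal A^*$ let $\underline X=\sum_{x\in X}x$ be its formal sum in the algebra of formal power series $\mathbb Z\langle\langle\mathcal A\rangle\rangle$, and $\equiv_n$ the congruence on this algebra generated by $a^n=\varepsilon$ ($\varepsilon$ the empty word; exponents of $a$ are thus read modulo $n$). For finite $P,Q\subseteq\mathbb Z$, $(P,Q)$ borders an $n$-cbc $X$ if $\underline{a^P}\,\underline X\,\underline{a^Q}\equiv_n\sum_{i,j\in[n]}a^iba^j$ (products taken with multiplicity), and borders a set of $n$-cbc if it borders each of its elements. -}

module Defs where

open import Data.Nat using (ℕ; zero; suc; _+_; _*_; NonZero)
open import Data.Nat.DivMod using (_%_)
open import Data.Integer using (ℤ; +_; _%ℕ_)
import Data.Integer as ℤ
open import Data.Fin using (Fin; toℕ)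
open import Data.List using (List; []; _∷_; _++_; concat; replicate; map; allFin)
open import Data.Nat.ListAction using (sum)
open import Data.Bool.ListAction using (any)
open import Data.List.Relation.Unary.All using (All)
open import Data.Bool using (Bool; true; false; if_then_else_; _∧_)
open import Data.Product using (Σ; ∃; _×_; _,_)
open import Data.Sum using (_⊎_)
open import Relation.Binary.PropositionalEquality using (_≡_)
open import Relation.Nullary.Decidable using (⌊_⌋)
import Data.Nat as ℕ

IsCode : {A : Set} → (List A → Set) → Set
IsCode {A} C = (xs ys : List (List A)) → All C xs → All C ys →
               concat xs ≡ concat ys → xs ≡ ys

_^w_ : {A : Set} → A → ℕ → List A
x ^w k = replicate k x

-- Subsets of a^[n] b a^[n], represented by their (Boolean) indicator on
-- pairs (i , j) ∈ [n] × [n]; the pair (i , j) stands for the word a^i b a^j.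

Sub : ℕ → Set
Sub n = Fin n → Fin n → Bool

wordsOf : {A : Set} (a b : A) {n : ℕ} → Sub n → List A → Set
wordsOf a b {n} X w = Σ (Fin n) λ i → Σ (Fin n) λ j →
  (X i j ≡ true) × (w ≡ (a ^w toℕ i) ++ (b ∷ (a ^w toℕ j)))

withAn : {A : Set} (a b : A) {n : ℕ} → Sub n → List A → Set
withAn a b {n} X w = (w ≡ a ^w n) ⊎ wordsOf a b X w

card : {n : ℕ} → Sub n → ℕ
card {n} X = sum (map (λ i → sum (map (λ j → if X i j then 1 else 0) (allFin n))) (allFin n))

IsCbc : {A : Set} (a b : A) (n : ℕ) → Sub n → Set
IsCbc a b n X = (card X ≡ n) × IsCode (withAn a b X)

compose : (n : ℕ) .{{_ : NonZero n}} → Sub n → Fin n → Sub n → Sub n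
compose n X r Y i l =
  any (λ j → any (λ k → X i j ∧ Y k l ∧ ⌊ (toℕ j + toℕ k) % n ℕ.≟ toℕ r ⌋) (allFin n)) (allFin n)

Family : ℕ → Set₁
Family n = Sub n → Set

data Compositions (n : ℕ) .{{_ : NonZero n}} (E : Family n) : Sub n → Set where
  single : ∀ {X} → E X → Compositions n E X
  step   : ∀ {X Y} → Compositions n E X → (r : Fin n) → E Y →
           Compositions n E (compose n X r Y)

Compatible : {A : Set} (a b : A) (n : ℕ) .{{_ : NonZero n}} → Family n → Set
Compatible a b n E = ∀ X → Compositions n E X → IsCbc a b n X

data StableOf (n : ℕ) .{{_ : NonZero n}} (E : Family n) : Sub n → Set where
  base : ∀ {X} → E X → StableOf n E X
  comp : ∀ {X Y} → StableOf n E X → (r : Fin n) → StableOf n E Y →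
         StableOf n E (compose n X r Y)

-- For finite P, Q ⊆ ℤ (lists without repetition),
-- a^P X a^Q reduced modulo a^n = ε is a ℤ-combination of the words
-- a^i b a^j, i,j ∈ [n]; coeff gives the coefficient of a^i b a^j
-- (products counted with multiplicity).

coeff : (n : ℕ) .{{_ : NonZero n}} → List ℤ → Sub n → List ℤ → Fin n → Fin n → ℕ
coeff n P X Q i j =
  sum (map (λ p → sum (map (λ q → sum (map (λ x → sum (map (λ y →
    if X x y ∧ ⌊ (p ℤ.+ + toℕ x) %ℕ n ℕ.≟ toℕ i ⌋ ∧ ⌊ (+ toℕ y ℤ.+ q) %ℕ n ℕ.≟ toℕ j ⌋
    then 1 else 0) (allFin n))) (allFin n))) Q)) P)

-- (P,Q) borders X : a^P X a^Q ≡ₙ Σ_{i,j∈[n]} a^i b a^j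
Borders : (n : ℕ) .{{_ : NonZero n}} → List ℤ → List ℤ → Sub n → Set
Borders n P Q X = ∀ i j → coeff n P X Q i j ≡ 1

BordersFamily : (n : ℕ) .{{_ : NonZero n}} → List ℤ → List ℤ → Family n → Set
BordersFamily n P Q S = ∀ X → S X → Borders n P Q X

phi : (n : ℕ) .{{_ : NonZero n}} → ℤ → ℤ → Sub n → Sub n
phi n d₁ d₂ X i' j' =
  any (λ i → any (λ j → X i j
      ∧ ⌊ (d₁ ℤ.* + toℕ i) %ℕ n ℕ.≟ toℕ i' ⌋
      ∧ ⌊ (d₂ ℤ.* + toℕ j) %ℕ n ℕ.≟ toℕ j' ⌋) (allFin n)) (allFin n)

insert : {n : ℕ} → Sub n → Family n → Family n
insert Y E Z = (Z ≡ Y) ⊎ E Z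

module Submission where

-- A subset X of a^[n] b a^[n] is its 0/1 matrix ⟦ X ⟧ over ℤ/n, and P, Q are histograms in the
-- group semiring ℕ[ℤ/n].  Then (P,Q) borders M iff every coefficient (P ∗ rightBorder M v) u is 1,
-- and for a composition U ∘⟨ r ⟩ Y this coefficient is (leftBorder U u ∗ rightBorder Y v) r.
-- Tijdeman's lemma: if A ∗ B ≋ 1 then A ∗ dil D B ≋ 1 for every D prime to the mass |B| of B.  For a
-- prime D it follows from the Frobenius congruence B ^ D ≡ dil D B (mod D): A ∗ B ^ D is the constant
-- |B| ^ (D - 1), which D does not divide, so no coefficient of A ∗ dil D B vanishes, and the total
-- mass is that of A ∗ B.  Since |rightBorder Y v| = |Q| and dilating Y on the left dilates
-- rightBorder Y v, adjoining a left dilation of X to a family whose compositions are all bordered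
-- keeps them bordered; right dilations follow by transposition, which swaps P and Q.  Bordered
-- matrices are 0/1, so the ℕ-valued compositions are the set compositions, φ(X) is the double
-- dilation of ⟦ X ⟧, and every set in the new stable has n elements.  Finally, a composition without
-- entries ≥ 2 never offers two ways to continue a parsing, so parsings over {aⁿ} ∪ Z are unique.

open import Algebra.Bundles using (Semiring)
import Algebra.Definitions.RawSemiring as RawSemiring
import Algebra.Properties.Semiring.Binomial as Binomial
open import Algebra.Structures using (IsSemiring)
open import Data.Bool using (Bool; true; false; T; if_then_else_; _∧_)
open import Data.Bool.ListAction using (any)
open import Data.Bool.Properties using (T-≡)
open import Data.Empty using (⊥; ⊥-elim)
open import Data.Fin using (Fin; zero; suc; toℕ; fromℕ; fromℕ<; inject₁)
open import Data.Fin.Properties using (_≟_)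
import Data.Fin.Properties as Finₚ
open import Data.Integer as ℤ using (ℤ; ∣_∣)
open import Data.Integer.DivMod using (a≡a%ℕn+[a/ℕn]*n; n%ℕd<d)
import Data.Integer.Divisibility.Signed as ℤ∣
import Data.Integer.Properties as ℤₚ
import Data.Integer.Solver as ℤ-Solver
open import Data.List using (List; []; _∷_; _++_; concat; map; allFin; tabulate; length; lookup)
open import Data.List.Membership.Propositional.Properties using (∈-allFin)
open import Data.List.Properties using (map-tabulate; ++-assoc; ∷-injectiveˡ; ∷-injectiveʳ)
open import Data.List.Relation.Unary.All using (All; []; _∷_)
import Data.List.Relation.Unary.Any as Any
open import Data.List.Relation.Unary.Any.Properties using (any⁺)
open import Data.List.Relation.Unary.Unique.Propositional using (Unique)
open import Data.Nat as ℕ using (ℕ; zero; suc; _+_; _*_; _∸_; _^_; _≤_; _<_; z≤n; s≤s; NonZero; >-nonZero; >-nonZero⁻¹; ≢-nonZero; ≢-nonZero⁻¹)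
open import Data.Nat.Combinatorics using (_C_; nCn≡1; nCk+nC[k+1]≡[n+1]C[k+1])
open import Data.Nat.Coprimality using (Coprime; coprime-divisor; prime⇒coprime)
open import Data.Nat.Divisibility using (_∣_; _∣0; divides; ∣-trans; ∣m∣n⇒∣m+n; ∣m+n∣m⇒∣n; ∣m⇒∣m*n; ∣n⇒∣m*n; m∣m*n)
open import Data.Nat.DivMod using (_%_; m%n<n; m%n%n≡m%n; %-distribˡ-+; %-distribˡ-*; m<n⇒m%n≡m; n%n≡0; m*n%n≡0; [m+kn]%n≡m%n)
import Data.Nat.ListAction as List
open import Data.Nat.ListAction using (product)
open import Data.Nat.Primality using (Prime; euclidsLemma; ¬prime[1])
open import Data.Nat.Primality.Factorisation using (factorise; PrimeFactorisation)
open import Data.Nat.Properties hiding (_≟_)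
open import Data.Nat.Solver using (module +-*-Solver)
open import Data.Product using (∃; _×_; _,_; proj₁; proj₂)
open import Data.Sum using (_⊎_; inj₁; inj₂)
open import Data.Unit using (⊤; tt)
open import Function using (_∘_; const)
open import Function.Bundles using (Equivalence)
open import Relation.Binary.PropositionalEquality hiding ([_])
open import Relation.Nullary using (Dec; yes; no; ¬_)
open import Relation.Nullary.Decidable using (⌊_⌋; fromWitness)

open import Defs

open import Algebra.Properties.Semiring.Sum +-*-semiring
  using (sum; sum-syntax; sum-cong-≗; ∑-comm; ∑-distrib-+; *-distribˡ-sum; *-distribʳ-sum; sum-init-last)

𝟙 : Bool → ℕ
𝟙 b = if b then 1 else 0

𝟙-∧ : ∀ a b → 𝟙 (a ∧ b) ≡ 𝟙 a * 𝟙 b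
𝟙-∧ false b = refl
𝟙-∧ true  b = sym (+-identityʳ (𝟙 b))

𝟙⌊⌋-⇔ : ∀ {A B : Set} (a? : Dec A) (b? : Dec B) → (A → B) → (B → A) → 𝟙 ⌊ a? ⌋ ≡ 𝟙 ⌊ b? ⌋
𝟙⌊⌋-⇔ (yes _) (yes _) _ _ = refl
𝟙⌊⌋-⇔ (yes a) (no ¬b) f _ = ⊥-elim (¬b (f a))
𝟙⌊⌋-⇔ (no ¬a) (yes b) _ g = ⊥-elim (¬a (g b))
𝟙⌊⌋-⇔ (no _)  (no _)  _ _ = refl

δ : ∀ {m} → Fin m → Fin m → ℕ
δ i j = 𝟙 ⌊ i ≟ j ⌋

δ-⇔ : ∀ {m m′} {i j : Fin m} {k l : Fin m′} → (i ≡ j → k ≡ l) → (k ≡ l → i ≡ j) → δ i j ≡ δ k l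
δ-⇔ {i = i} {j} {k} {l} = 𝟙⌊⌋-⇔ (i ≟ j) (k ≟ l)

δ-refl : ∀ {m} (i : Fin m) → δ i i ≡ 1
δ-refl i with i ≟ i
... | yes _  = refl
... | no i≢i = ⊥-elim (i≢i refl)

δ-sym : ∀ {m} (i j : Fin m) → δ i j ≡ δ j i
δ-sym i j = δ-⇔ sym sym

δ-suc : ∀ {m} (i j : Fin m) → δ (suc i) (suc j) ≡ δ i j
δ-suc i j = δ-⇔ Finₚ.suc-injective (cong suc)

∑-const : ∀ m c → ∑[ i < m ] c ≡ m * c
∑-const zero    c = refl
∑-const (suc m) c = cong (c +_) (∑-const m c)

∑-zero : ∀ m → ∑[ i < m ] 0 ≡ 0
∑-zero m = trans (∑-const m 0) (*-zeroʳ m)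

sum-allFin : ∀ {m} (f : Fin m → ℕ) → List.sum (map f (allFin m)) ≡ sum f
sum-allFin {m} f = trans (cong List.sum (map-tabulate (λ i → i) f)) (sum-tabulate f)
  where
  sum-tabulate : ∀ {k} (g : Fin k → ℕ) → List.sum (tabulate g) ≡ sum g
  sum-tabulate {zero}  g = refl
  sum-tabulate {suc k} g = cong (g zero +_) (sum-tabulate (g ∘ suc))

sum-map≡∑-lookup : ∀ {A : Set} (f : A → ℕ) (L : List A) → List.sum (map f L) ≡ ∑[ t < length L ] f (lookup L t)
sum-map≡∑-lookup f []      = refl
sum-map≡∑-lookup f (x ∷ L) = cong (f x +_) (sum-map≡∑-lookup f L)

∑-δˡ : ∀ {m} (i : Fin m) (f : Fin m → ℕ) → ∑[ j < m ] (δ i j * f j) ≡ f i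
∑-δˡ {suc m} zero    f = trans (cong (f zero + 0 +_) (∑-zero m)) (trans (+-identityʳ _) (+-identityʳ _))
∑-δˡ {suc m} (suc i) f = trans (sum-cong-≗ (λ j → cong (_* f (suc j)) (δ-suc i j))) (∑-δˡ i (f ∘ suc))

∑-δʳ : ∀ {m} (i : Fin m) (f : Fin m → ℕ) → ∑[ j < m ] (f j * δ j i) ≡ f i
∑-δʳ i f = trans (sum-cong-≗ (λ j → trans (*-comm (f j) _) (cong (_* f j) (δ-sym j i)))) (∑-δˡ i f)

∑-δ : ∀ {m} (i : Fin m) → ∑[ j < m ] δ i j ≡ 1
∑-δ i = trans (sum-cong-≗ (λ j → sym (*-identityʳ (δ i j)))) (∑-δˡ i (λ _ → 1))

∑-sift : ∀ {m} c (x : Fin m) (h : Fin m → ℕ) → ∑[ r < m ] (c * δ x r * h r) ≡ c * h x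
∑-sift c x h = trans (sum-cong-≗ (λ r → *-assoc c (δ x r) (h r)))
                     (trans (sym (*-distribˡ-sum c (λ r → δ x r * h r))) (cong (c *_) (∑-δˡ x h)))

∑∑-δˡ : ∀ {m k} (c : Fin m) (G : Fin m → Fin k → ℕ) → ∑[ a < m ] ∑[ x < k ] (δ c a * G a x) ≡ ∑[ x < k ] G c x
∑∑-δˡ {m} {k} c G = trans (sum-cong-≗ λ a → sym (*-distribˡ-sum (δ c a) (G a))) (∑-δˡ c (λ a → ∑[ x < k ] G a x))

∑-comm₃ : ∀ {m} (F : Fin m → Fin m → Fin m → ℕ) →
          ∑[ a < m ] ∑[ b < m ] ∑[ c < m ] F a b c ≡ ∑[ b < m ] ∑[ c < m ] ∑[ a < m ] F a b c
∑-comm₃ F = trans (∑-comm (λ a b → ∑[ c < _ ] F a b c)) (sum-cong-≗ (λ b → ∑-comm (λ a c → F a b c)))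

∑-comm₂₂ : ∀ {m} (F : Fin m → Fin m → Fin m → Fin m → ℕ) →
           ∑[ a < m ] ∑[ b < m ] ∑[ c < m ] ∑[ d < m ] F a b c d ≡ ∑[ c < m ] ∑[ d < m ] ∑[ a < m ] ∑[ b < m ] F a b c d
∑-comm₂₂ F = trans (sum-cong-≗ λ a → ∑-comm₃ (λ b c d → F a b c d)) (∑-comm₃ (λ a c d → ∑[ b < _ ] F a b c d))

∑-*-* : ∀ {m} (F : Fin m → ℕ) x y → sum F * x * y ≡ ∑[ j < m ] (F j * x * y)
∑-*-* F x y = trans (cong (_* y) (*-distribʳ-sum x F)) (*-distribʳ-sum y (λ j → F j * x))

∑∑-* : ∀ {m k} (F : Fin m → Fin k → ℕ) y → ∑[ j < m ] ∑[ l < k ] F j l * y ≡ ∑[ j < m ] ∑[ l < k ] (F j l * y)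
∑∑-* F y = trans (*-distribʳ-sum y (λ j → sum (F j))) (sum-cong-≗ λ j → *-distribʳ-sum y (F j))

∑∑-*-* : ∀ {m} (F : Fin m → Fin m → ℕ) x y → ∑[ j < m ] ∑[ k < m ] F j k * x * y ≡ ∑[ j < m ] ∑[ k < m ] (F j k * x * y)
∑∑-*-* F x y = trans (cong (_* y) (∑∑-* F x)) (∑∑-* (λ j k → F j k * x) y)

*-∑∑-* : ∀ {m} x (F : Fin m → Fin m → ℕ) y → x * ∑[ j < m ] ∑[ k < m ] F j k * y ≡ ∑[ j < m ] ∑[ k < m ] (x * F j k * y)
*-∑∑-* x F y = trans (cong (_* y) (trans (*-distribˡ-sum x (λ j → sum (F j))) (sum-cong-≗ λ j → *-distribˡ-sum x (F j))))
                     (∑∑-* (λ j k → x * F j k) y)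

∑-mono-≤ : ∀ {m} {f g : Fin m → ℕ} → (∀ i → f i ≤ g i) → sum f ≤ sum g
∑-mono-≤ {zero}  f≤g = z≤n
∑-mono-≤ {suc m} f≤g = +-mono-≤ (f≤g zero) (∑-mono-≤ (f≤g ∘ suc))

∑-≥⇒≗ : ∀ {m} {f g : Fin m → ℕ} → (∀ i → f i ≤ g i) → sum g ≤ sum f → ∀ i → f i ≡ g i
∑-≥⇒≗ {suc m} {f} {g} f≤g ∑g≤∑f zero = ≤-antisym (f≤g zero)
  (+-cancelʳ-≤ (sum (f ∘ suc)) (g zero) (f zero) (≤-trans (+-monoʳ-≤ (g zero) (∑-mono-≤ (f≤g ∘ suc))) ∑g≤∑f))
∑-≥⇒≗ {suc m} {f} {g} f≤g ∑g≤∑f (suc i) = ∑-≥⇒≗ (f≤g ∘ suc)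
  (+-cancelˡ-≤ (g zero) _ _ (≤-trans ∑g≤∑f (+-monoˡ-≤ _ (f≤g zero)))) i

term≤∑ : ∀ {m} (f : Fin m → ℕ) i → f i ≤ sum f
term≤∑ f zero    = m≤m+n _ _
term≤∑ f (suc i) = ≤-trans (term≤∑ (f ∘ suc) i) (m≤n+m _ _)

term≤∑∑ : ∀ {m} (F : Fin m → Fin m → ℕ) a b → F a b ≤ ∑[ a < m ] ∑[ b < m ] F a b
term≤∑∑ F a b = ≤-trans (term≤∑ (F a) b) (term≤∑ (λ a → sum (F a)) a)

two-terms≤∑ : ∀ {m} (f : Fin m → ℕ) {i j} → i ≢ j → f i + f j ≤ sum f
two-terms≤∑ f {zero}  {zero}  i≢j = ⊥-elim (i≢j refl)
two-terms≤∑ f {zero}  {suc j} i≢j = +-monoʳ-≤ (f zero) (term≤∑ (f ∘ suc) j)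
two-terms≤∑ f {suc i} {zero}  i≢j = subst (_≤ sum f) (+-comm (f zero) _) (+-monoʳ-≤ (f zero) (term≤∑ (f ∘ suc) i))
two-terms≤∑ f {suc i} {suc j} i≢j = ≤-trans (two-terms≤∑ (f ∘ suc) (i≢j ∘ cong suc)) (m≤n+m _ (f zero))

∑-positive : ∀ {m} (f : Fin m → ℕ) → 1 ≤ sum f → ∃ λ i → 1 ≤ f i
∑-positive {suc m} f ∑f≥1 with f zero in eq
... | suc _ = zero , subst (1 ≤_) (sym eq) (s≤s z≤n)
... | zero with ∑-positive (f ∘ suc) ∑f≥1
...   | i , fi≥1 = suc i , fi≥1

∣-∑ : ∀ {m} d (f : Fin m → ℕ) → (∀ i → d ∣ f i) → d ∣ sum f
∣-∑ {zero}  d f d∣f = d ∣0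
∣-∑ {suc m} d f d∣f = ∣m∣n⇒∣m+n (d∣f zero) (∣-∑ d (f ∘ suc) (d∣f ∘ suc))

any-allFin : ∀ {m} (f : Fin m → Bool) x → f x ≡ true → any f (allFin m) ≡ true
any-allFin f x fx≡true = Equivalence.to T-≡
  (any⁺ f (Any.map (λ x≡y → subst (T ∘ f) x≡y (Equivalence.from T-≡ fx≡true)) (∈-allFin x)))

module _ {A : Set} (f : A → Bool) where

  𝟙-any≤sum : ∀ (L : List A) → 𝟙 (any f L) ≤ List.sum (map (𝟙 ∘ f) L)
  𝟙-any≤sum []      = z≤n
  𝟙-any≤sum (x ∷ L) with f x
  ... | true  = s≤s z≤n
  ... | false = 𝟙-any≤sum L

  𝟙-any≡sum : ∀ (L : List A) → List.sum (map (𝟙 ∘ f) L) ≤ 1 → 𝟙 (any f L) ≡ List.sum (map (𝟙 ∘ f) L)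
  𝟙-any≡sum []      _     = refl
  𝟙-any≡sum (x ∷ L) sum≤1 with f x
  ... | true  = sym (cong suc (n≤0⇒n≡0 (≤-pred sum≤1)))
  ... | false = 𝟙-any≡sum L sum≤1

module _ {m : ℕ} where

  private
    𝟙-any≤∑ : ∀ f → 𝟙 (any f (allFin m)) ≤ ∑[ i < m ] 𝟙 (f i)
    𝟙-any≤∑ f = subst (𝟙 (any f (allFin m)) ≤_) (sum-allFin (𝟙 ∘ f)) (𝟙-any≤sum f (allFin m))

    𝟙-any≡∑ : ∀ f → ∑[ i < m ] 𝟙 (f i) ≤ 1 → 𝟙 (any f (allFin m)) ≡ ∑[ i < m ] 𝟙 (f i)
    𝟙-any≡∑ f ∑≤1 = trans (𝟙-any≡sum f (allFin m) (subst (_≤ 1) (sym (sum-allFin (𝟙 ∘ f))) ∑≤1)) (sum-allFin (𝟙 ∘ f))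

  𝟙-any²≤∑∑ : ∀ (F : Fin m → Fin m → Bool) →
              𝟙 (any (λ j → any (F j) (allFin m)) (allFin m)) ≤ ∑[ j < m ] ∑[ k < m ] 𝟙 (F j k)
  𝟙-any²≤∑∑ F = ≤-trans (𝟙-any≤∑ _) (∑-mono-≤ (λ j → 𝟙-any≤∑ (F j)))

  𝟙-any²≡∑∑ : ∀ (F : Fin m → Fin m → Bool) → ∑[ j < m ] ∑[ k < m ] 𝟙 (F j k) ≤ 1 →
              𝟙 (any (λ j → any (F j) (allFin m)) (allFin m)) ≡ ∑[ j < m ] ∑[ k < m ] 𝟙 (F j k)
  𝟙-any²≡∑∑ F ∑∑≤1 = trans (𝟙-any≡∑ _ (≤-trans (∑-mono-≤ (λ j → 𝟙-any≤∑ (F j))) ∑∑≤1))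
    (sum-cong-≗ λ j → 𝟙-any≡∑ (F j) (≤-trans (term≤∑ (λ j → ∑[ k < m ] 𝟙 (F j k)) j) ∑∑≤1))

module Mod (n : ℕ) .{{_ : NonZero n}} where

  infixl 6 _⊕_
  infixr 7 _⊙_

  [_] : ℕ → Fin n
  [ x ] = fromℕ< (m%n<n x n)

  toℕ-[] : ∀ x → toℕ [ x ] ≡ x % n
  toℕ-[] x = Finₚ.toℕ-fromℕ< (m%n<n x n)

  []-toℕ : ∀ i → [ toℕ i ] ≡ i
  []-toℕ i = Finₚ.toℕ-injective (trans (toℕ-[] (toℕ i)) (m<n⇒m%n≡m (Finₚ.toℕ<n i)))

  []-cong : ∀ {x y} → x % n ≡ y % n → [ x ] ≡ [ y ]
  []-cong {x} {y} eq = Finₚ.toℕ-injective (trans (toℕ-[] x) (trans eq (sym (toℕ-[] y))))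

  _⊕_ : Fin n → Fin n → Fin n
  i ⊕ j = [ toℕ i + toℕ j ]

  _⊙_ : ℕ → Fin n → Fin n
  c ⊙ i = [ c * toℕ i ]

  0̂ : Fin n
  0̂ = [ 0 ]

  ⊖_ : Fin n → Fin n
  ⊖ i = [ n ∸ toℕ i ]

  []-+ : ∀ x y → [ x + y ] ≡ [ x ] ⊕ [ y ]
  []-+ x y = []-cong (begin
    (x + y) % n               ≡⟨ %-distribˡ-+ x y n ⟩
    (x % n + y % n) % n       ≡⟨ cong₂ (λ u v → (u + v) % n) (toℕ-[] x) (toℕ-[] y) ⟨
    (toℕ [ x ] + toℕ [ y ]) % n ∎)
    where open ≡-Reasoning

  []-* : ∀ c x → [ c * x ] ≡ c ⊙ [ x ]
  []-* c x = []-cong (begin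
    (c * x) % n                ≡⟨ %-distribˡ-* c x n ⟩
    (c % n * (x % n)) % n      ≡⟨ cong (λ u → (c % n * u) % n) (m%n%n≡m%n x n) ⟨
    (c % n * (x % n % n)) % n  ≡⟨ %-distribˡ-* c (x % n) n ⟨
    (c * (x % n)) % n          ≡⟨ cong (λ u → (c * u) % n) (toℕ-[] x) ⟨
    (c * toℕ [ x ]) % n        ∎)
    where open ≡-Reasoning

  ⊕-comm : ∀ i j → i ⊕ j ≡ j ⊕ i
  ⊕-comm i j = cong [_] (+-comm (toℕ i) (toℕ j))

  ⊕-assoc : ∀ i j k → (i ⊕ j) ⊕ k ≡ i ⊕ (j ⊕ k)
  ⊕-assoc i j k = begin
    [ toℕ i + toℕ j ] ⊕ k            ≡⟨ cong ([ toℕ i + toℕ j ] ⊕_) ([]-toℕ k) ⟨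
    [ toℕ i + toℕ j ] ⊕ [ toℕ k ]    ≡⟨ []-+ (toℕ i + toℕ j) (toℕ k) ⟨
    [ toℕ i + toℕ j + toℕ k ]        ≡⟨ cong [_] (+-assoc (toℕ i) (toℕ j) (toℕ k)) ⟩
    [ toℕ i + (toℕ j + toℕ k) ]      ≡⟨ []-+ (toℕ i) (toℕ j + toℕ k) ⟩
    [ toℕ i ] ⊕ [ toℕ j + toℕ k ]    ≡⟨ cong (_⊕ (j ⊕ k)) ([]-toℕ i) ⟩
    i ⊕ (j ⊕ k)                      ∎
    where open ≡-Reasoning

  ⊕-identityˡ : ∀ i → 0̂ ⊕ i ≡ i
  ⊕-identityˡ i = begin
    [ toℕ [ 0 ] + toℕ i ]  ≡⟨ cong (λ u → [ u + toℕ i ]) (trans (toℕ-[] 0) (m*n%n≡0 0 n)) ⟩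
    [ toℕ i ]              ≡⟨ []-toℕ i ⟩
    i                      ∎
    where open ≡-Reasoning

  ⊕-identityʳ : ∀ i → i ⊕ 0̂ ≡ i
  ⊕-identityʳ i = trans (⊕-comm i 0̂) (⊕-identityˡ i)

  ⊕-inverseʳ : ∀ i → i ⊕ ⊖ i ≡ 0̂
  ⊕-inverseʳ i = begin
    i ⊕ ⊖ i                          ≡⟨ cong (_⊕ ⊖ i) ([]-toℕ i) ⟨
    [ toℕ i ] ⊕ [ n ∸ toℕ i ]        ≡⟨ []-+ (toℕ i) (n ∸ toℕ i) ⟨
    [ toℕ i + (n ∸ toℕ i) ]          ≡⟨ cong [_] (m+[n∸m]≡n (<⇒≤ (Finₚ.toℕ<n i))) ⟩
    [ n ]                            ≡⟨ []-cong (trans (n%n≡0 n) (sym (m*n%n≡0 0 n))) ⟩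
    0̂                                ∎
    where open ≡-Reasoning

  ⊕-cancelʳ : ∀ {j k r} → j ⊕ k ≡ r → j ≡ r ⊕ ⊖ k
  ⊕-cancelʳ {j} {k} {r} j⊕k≡r = begin
    j                ≡⟨ ⊕-identityʳ j ⟨
    j ⊕ 0̂            ≡⟨ cong (j ⊕_) (⊕-inverseʳ k) ⟨
    j ⊕ (k ⊕ ⊖ k)    ≡⟨ ⊕-assoc j k (⊖ k) ⟨
    j ⊕ k ⊕ ⊖ k      ≡⟨ cong (_⊕ ⊖ k) j⊕k≡r ⟩
    r ⊕ ⊖ k          ∎
    where open ≡-Reasoning

  ⊕-uncancelʳ : ∀ {j k r} → j ≡ r ⊕ ⊖ k → j ⊕ k ≡ r
  ⊕-uncancelʳ {j} {k} {r} refl = begin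
    r ⊕ ⊖ k ⊕ k      ≡⟨ ⊕-assoc r (⊖ k) k ⟩
    r ⊕ (⊖ k ⊕ k)    ≡⟨ cong (r ⊕_) (trans (⊕-comm (⊖ k) k) (⊕-inverseʳ k)) ⟩
    r ⊕ 0̂            ≡⟨ ⊕-identityʳ r ⟩
    r                ∎
    where open ≡-Reasoning

  ⊙-assoc : ∀ c d i → (c * d) ⊙ i ≡ c ⊙ d ⊙ i
  ⊙-assoc c d i = trans (cong [_] (*-assoc c d (toℕ i))) ([]-* c (d * toℕ i))

  ⊙-identityˡ : ∀ i → 1 ⊙ i ≡ i
  ⊙-identityˡ i = trans (cong [_] (*-identityˡ (toℕ i))) ([]-toℕ i)

  suc-⊙ : ∀ m i → suc m ⊙ i ≡ i ⊕ m ⊙ i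
  suc-⊙ m i = trans ([]-+ (toℕ i) (m * toℕ i)) (cong (_⊕ m ⊙ i) ([]-toℕ i))

module GroupSemiring (n : ℕ) .{{_ : NonZero n}} where

  open +-*-Solver using (solve; _:*_; _:=_)

  open Mod n

  infix  4 _≋_
  infixl 6 _+ᶠ_
  infixl 7 _∗_

  Fn : Set
  Fn = Fin n → ℕ

  _≋_ : Fn → Fn → Set
  f ≋ g = ∀ r → f r ≡ g r

  _+ᶠ_ : Fn → Fn → Fn
  (f +ᶠ g) r = f r + g r

  0ᶠ : Fn
  0ᶠ _ = 0

  _∗_ : Fn → Fn → Fn
  (f ∗ g) r = ∑[ j < n ] ∑[ k < n ] (f j * g k * δ (j ⊕ k) r)

  mass : Fn → ℕ
  mass f = sum f

  dil : ℕ → Fn → Fn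
  dil c f r = ∑[ k < n ] (f k * δ (c ⊙ k) r)

  ∗-cong : ∀ {f f′ g g′} → f ≋ f′ → g ≋ g′ → f ∗ g ≋ f′ ∗ g′
  ∗-cong f≋f′ g≋g′ r = sum-cong-≗ λ j → sum-cong-≗ λ k →
    cong₂ (λ a b → a * b * δ (j ⊕ k) r) (f≋f′ j) (g≋g′ k)

  ∗-comm : ∀ f g → f ∗ g ≋ g ∗ f
  ∗-comm f g r = trans (∑-comm (λ j k → f j * g k * δ (j ⊕ k) r)) (sum-cong-≗ λ k → sum-cong-≗ λ j →
    cong₂ _*_ (*-comm (f j) (g k)) (cong (λ x → δ x r) (⊕-comm j k)))

  ∗-pairing : ∀ f g h → ∑[ r < n ] ((f ∗ g) r * h r) ≡ ∑[ j < n ] ∑[ k < n ] (f j * g k * h (j ⊕ k))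
  ∗-pairing f g h = begin
    ∑[ r < n ] ((f ∗ g) r * h r)
      ≡⟨ sum-cong-≗ (λ r → trans (*-distribʳ-sum (h r) (λ j → ∑[ k < n ] (f j * g k * δ (j ⊕ k) r)))
                                  (sum-cong-≗ λ j → *-distribʳ-sum (h r) (λ k → f j * g k * δ (j ⊕ k) r))) ⟩
    ∑[ r < n ] ∑[ j < n ] ∑[ k < n ] (f j * g k * δ (j ⊕ k) r * h r)
      ≡⟨ ∑-comm₃ (λ r j k → f j * g k * δ (j ⊕ k) r * h r) ⟩
    ∑[ j < n ] ∑[ k < n ] ∑[ r < n ] (f j * g k * δ (j ⊕ k) r * h r)
      ≡⟨ sum-cong-≗ (λ j → sum-cong-≗ λ k → ∑-sift (f j * g k) (j ⊕ k) h) ⟩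
    ∑[ j < n ] ∑[ k < n ] (f j * g k * h (j ⊕ k)) ∎
    where open ≡-Reasoning

  mass-∗ : ∀ f g → mass (f ∗ g) ≡ mass f * mass g
  mass-∗ f g = begin
    ∑[ r < n ] (f ∗ g) r                      ≡⟨ sum-cong-≗ (λ r → *-identityʳ ((f ∗ g) r)) ⟨
    ∑[ r < n ] ((f ∗ g) r * 1)                ≡⟨ ∗-pairing f g (λ _ → 1) ⟩
    ∑[ j < n ] ∑[ k < n ] (f j * g k * 1)     ≡⟨ sum-cong-≗ (λ j → trans (sum-cong-≗ λ k → *-identityʳ (f j * g k))
                                                                         (sym (*-distribˡ-sum (f j) g))) ⟩
    ∑[ j < n ] (f j * mass g)                 ≡⟨ *-distribʳ-sum (mass g) f ⟨
    mass f * mass g                           ∎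
    where open ≡-Reasoning

  ∗-assoc : ∀ f g h → (f ∗ g) ∗ h ≋ f ∗ (g ∗ h)
  ∗-assoc f g h r = trans left (sym right)
    where
    open ≡-Reasoning
    triple : ℕ
    triple = ∑[ j < n ] ∑[ k < n ] ∑[ c < n ] (f j * g k * h c * δ (j ⊕ k ⊕ c) r)
    left : ((f ∗ g) ∗ h) r ≡ triple
    left = begin
      ∑[ a < n ] ∑[ c < n ] ((f ∗ g) a * h c * δ (a ⊕ c) r)
        ≡⟨ ∑-comm (λ a c → (f ∗ g) a * h c * δ (a ⊕ c) r) ⟩
      ∑[ c < n ] ∑[ a < n ] ((f ∗ g) a * h c * δ (a ⊕ c) r)
        ≡⟨ sum-cong-≗ (λ c → trans (sum-cong-≗ λ a → *-assoc ((f ∗ g) a) (h c) _)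
                                   (∗-pairing f g (λ a → h c * δ (a ⊕ c) r))) ⟩
      ∑[ c < n ] ∑[ j < n ] ∑[ k < n ] (f j * g k * (h c * δ (j ⊕ k ⊕ c) r))
        ≡⟨ ∑-comm₃ (λ c j k → f j * g k * (h c * δ (j ⊕ k ⊕ c) r)) ⟩
      ∑[ j < n ] ∑[ k < n ] ∑[ c < n ] (f j * g k * (h c * δ (j ⊕ k ⊕ c) r))
        ≡⟨ sum-cong-≗ (λ j → sum-cong-≗ λ k → sum-cong-≗ λ c → sym (*-assoc (f j * g k) (h c) _)) ⟩
      triple ∎
    right : (f ∗ (g ∗ h)) r ≡ triple
    right = begin
      ∑[ j < n ] ∑[ b < n ] (f j * (g ∗ h) b * δ (j ⊕ b) r)
        ≡⟨ sum-cong-≗ (λ j → trans (sum-cong-≗ λ b → x*y*z≡y*[x*z] (f j) ((g ∗ h) b) (δ (j ⊕ b) r))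
                                   (∗-pairing g h (λ b → f j * δ (j ⊕ b) r))) ⟩
      ∑[ j < n ] ∑[ k < n ] ∑[ c < n ] (g k * h c * (f j * δ (j ⊕ (k ⊕ c)) r))
        ≡⟨ sum-cong-≗ (λ j → sum-cong-≗ λ k → sum-cong-≗ λ c →
             trans (x*y*[z*w]≡z*x*y*w (g k) (h c) (f j) _) (cong (λ x → f j * g k * h c * δ x r) (sym (⊕-assoc j k c)))) ⟩
      triple ∎
      where
      x*y*z≡y*[x*z] : ∀ x y z → x * y * z ≡ y * (x * z)
      x*y*z≡y*[x*z] = solve 3 (λ x y z → x :* y :* z := y :* (x :* z)) refl
      x*y*[z*w]≡z*x*y*w : ∀ x y z w → x * y * (z * w) ≡ z * x * y * w
      x*y*[z*w]≡z*x*y*w = solve 4 (λ x y z w → x :* y :* (z :* w) := z :* x :* y :* w) refl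

  ∗-identityˡ : ∀ g → δ 0̂ ∗ g ≋ g
  ∗-identityˡ g r = begin
    ∑[ j < n ] ∑[ k < n ] (δ 0̂ j * g k * δ (j ⊕ k) r)  ≡⟨ ∑-comm (λ j k → δ 0̂ j * g k * δ (j ⊕ k) r) ⟩
    ∑[ k < n ] ∑[ j < n ] (δ 0̂ j * g k * δ (j ⊕ k) r)  ≡⟨ sum-cong-≗ (λ k → trans (sum-cong-≗ λ j → cong (_* δ (j ⊕ k) r) (*-comm (δ 0̂ j) (g k)))
                                                                           (∑-sift (g k) 0̂ (λ j → δ (j ⊕ k) r))) ⟩
    ∑[ k < n ] (g k * δ (0̂ ⊕ k) r)                     ≡⟨ sum-cong-≗ (λ k → cong (λ x → g k * δ x r) (⊕-identityˡ k)) ⟩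
    ∑[ k < n ] (g k * δ k r)                           ≡⟨ ∑-δʳ r g ⟩
    g r                                                ∎
    where open ≡-Reasoning

  ∗-identityʳ : ∀ g → g ∗ δ 0̂ ≋ g
  ∗-identityʳ g r = trans (∗-comm g (δ 0̂) r) (∗-identityˡ g r)

  ∗-distribˡ-+ᶠ : ∀ f g h → f ∗ (g +ᶠ h) ≋ f ∗ g +ᶠ f ∗ h
  ∗-distribˡ-+ᶠ f g h r =
    trans (sum-cong-≗ λ j → trans (sum-cong-≗ λ k → distrib j k)
                                  (∑-distrib-+ (λ k → f j * g k * δ (j ⊕ k) r) (λ k → f j * h k * δ (j ⊕ k) r)))
          (∑-distrib-+ (λ j → ∑[ k < n ] (f j * g k * δ (j ⊕ k) r)) (λ j → ∑[ k < n ] (f j * h k * δ (j ⊕ k) r)))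
    where
    distrib : ∀ j k → f j * (g k + h k) * δ (j ⊕ k) r ≡ f j * g k * δ (j ⊕ k) r + f j * h k * δ (j ⊕ k) r
    distrib j k = trans (cong (_* δ (j ⊕ k) r) (*-distribˡ-+ (f j) (g k) (h k))) (*-distribʳ-+ _ (f j * g k) _)

  ∗-distribʳ-+ᶠ : ∀ f g h → (g +ᶠ h) ∗ f ≋ g ∗ f +ᶠ h ∗ f
  ∗-distribʳ-+ᶠ f g h r = trans (∗-comm (g +ᶠ h) f r)
    (trans (∗-distribˡ-+ᶠ f g h r) (cong₂ _+_ (∗-comm f g r) (∗-comm f h r)))

  ∗-zeroˡ : ∀ g → 0ᶠ ∗ g ≋ 0ᶠ
  ∗-zeroˡ g r = trans (sum-cong-≗ {x = λ j → ∑[ k < n ] (0 * g k * δ (j ⊕ k) r)} (λ _ → ∑-zero n)) (∑-zero n)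

  ∗-zeroʳ : ∀ g → g ∗ 0ᶠ ≋ 0ᶠ
  ∗-zeroʳ g r = trans (∗-comm g 0ᶠ r) (∗-zeroˡ g r)

  ∗-isSemiring : IsSemiring _≋_ _+ᶠ_ _∗_ 0ᶠ (δ 0̂)
  ∗-isSemiring = record
    { isSemiringWithoutAnnihilatingZero = record
      { +-isCommutativeMonoid = record
        { isMonoid = record
          { isSemigroup = record
            { isMagma = record
              { isEquivalence = record { refl = λ _ → refl ; sym = λ f≋g r → sym (f≋g r) ; trans = λ f≋g g≋h r → trans (f≋g r) (g≋h r) }
              ; ∙-cong = λ f≋f′ g≋g′ r → cong₂ _+_ (f≋f′ r) (g≋g′ r) }
            ; assoc = λ f g h r → +-assoc (f r) (g r) (h r) }
          ; identity = (λ f r → refl) , (λ f r → +-identityʳ (f r)) }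
        ; comm = λ f g r → +-comm (f r) (g r) }
      ; *-cong = ∗-cong
      ; *-assoc = ∗-assoc
      ; *-identity = ∗-identityˡ , ∗-identityʳ
      ; distrib = ∗-distribˡ-+ᶠ , ∗-distribʳ-+ᶠ }
    ; zero = ∗-zeroˡ , ∗-zeroʳ }

  ℕ[ℤ/n] : Semiring _ _
  ℕ[ℤ/n] = record { isSemiring = ∗-isSemiring }

  ∗-*ʳ : ∀ c f g → f ∗ (λ k → c * g k) ≋ λ r → c * (f ∗ g) r
  ∗-*ʳ c f g r = trans (sum-cong-≗ λ j → sum-cong-≗ λ k → x*[c*y]*z≡c*[x*y*z] (f j) c (g k) (δ (j ⊕ k) r))
    (trans (sum-cong-≗ λ j → sym (*-distribˡ-sum c (λ k → f j * g k * δ (j ⊕ k) r)))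
           (sym (*-distribˡ-sum c (λ j → ∑[ k < n ] (f j * g k * δ (j ⊕ k) r)))))
    where
    x*[c*y]*z≡c*[x*y*z] : ∀ x c y z → x * (c * y) * z ≡ c * (x * y * z)
    x*[c*y]*z≡c*[x*y*z] = solve 4 (λ x c y z → x :* (c :* y) :* z := c :* (x :* y :* z)) refl

  ∑-δ-⊕ : ∀ k r → ∑[ j < n ] δ (j ⊕ k) r ≡ 1
  ∑-δ-⊕ k r = trans (sum-cong-≗ λ j → δ-⊕ j) (∑-δ (r ⊕ ⊖ k))
    where
    δ-⊕ : ∀ j → δ (j ⊕ k) r ≡ δ (r ⊕ ⊖ k) j
    δ-⊕ j = δ-⇔ (λ j⊕k≡r → sym (⊕-cancelʳ j⊕k≡r)) (λ r⊖k≡j → ⊕-uncancelʳ (sym r⊖k≡j))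

  ∗-constˡ : ∀ c f g → (∀ r → f r ≡ c) → ∀ r → (f ∗ g) r ≡ c * mass g
  ∗-constˡ c f g f≡c r = begin
    ∑[ j < n ] ∑[ k < n ] (f j * g k * δ (j ⊕ k) r)  ≡⟨ ∑-comm (λ j k → f j * g k * δ (j ⊕ k) r) ⟩
    ∑[ k < n ] ∑[ j < n ] (f j * g k * δ (j ⊕ k) r)  ≡⟨ sum-cong-≗ (λ k → column k) ⟩
    ∑[ k < n ] (c * g k)                             ≡⟨ *-distribˡ-sum c g ⟨
    c * mass g                                       ∎
    where
    open ≡-Reasoning
    column : ∀ k → ∑[ j < n ] (f j * g k * δ (j ⊕ k) r) ≡ c * g k
    column k = begin
      ∑[ j < n ] (f j * g k * δ (j ⊕ k) r)   ≡⟨ sum-cong-≗ (λ j → cong (λ x → x * g k * δ (j ⊕ k) r) (f≡c j)) ⟩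
      ∑[ j < n ] (c * g k * δ (j ⊕ k) r)     ≡⟨ *-distribˡ-sum (c * g k) (λ j → δ (j ⊕ k) r) ⟨
      c * g k * ∑[ j < n ] δ (j ⊕ k) r       ≡⟨ cong (c * g k *_) (∑-δ-⊕ k r) ⟩
      c * g k * 1                            ≡⟨ *-identityʳ (c * g k) ⟩
      c * g k                                ∎

  δ-∗-δ : ∀ a b → δ a ∗ δ b ≋ δ (a ⊕ b)
  δ-∗-δ a b r = begin
    ∑[ j < n ] ∑[ k < n ] (δ a j * δ b k * δ (j ⊕ k) r)  ≡⟨ sum-cong-≗ (λ j → ∑-sift (δ a j) b (λ k → δ (j ⊕ k) r)) ⟩
    ∑[ j < n ] (δ a j * δ (j ⊕ b) r)                     ≡⟨ ∑-δˡ a (λ j → δ (j ⊕ b) r) ⟩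
    δ (a ⊕ b) r                                          ∎
    where open ≡-Reasoning

  dil-cong : ∀ c {f g} → f ≋ g → dil c f ≋ dil c g
  dil-cong c f≋g r = sum-cong-≗ λ k → cong (_* δ (c ⊙ k) r) (f≋g k)

  dil-δ : ∀ c a → dil c (δ a) ≋ δ (c ⊙ a)
  dil-δ c a r = ∑-δˡ a (λ k → δ (c ⊙ k) r)

  dil-+ᶠ : ∀ c f g → dil c (f +ᶠ g) ≋ dil c f +ᶠ dil c g
  dil-+ᶠ c f g r = trans (sum-cong-≗ λ k → *-distribʳ-+ (δ (c ⊙ k) r) (f k) (g k))
                         (∑-distrib-+ (λ k → f k * δ (c ⊙ k) r) (λ k → g k * δ (c ⊙ k) r))

  dil-identity : ∀ f → dil 1 f ≋ f
  dil-identity f r = trans (sum-cong-≗ λ k → cong (λ x → f k * δ x r) (⊙-identityˡ k)) (∑-δʳ r f)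

  dil-* : ∀ c d f → dil (c * d) f ≋ dil c (dil d f)
  dil-* c d f r = begin
    ∑[ k < n ] (f k * δ ((c * d) ⊙ k) r)                      ≡⟨ sum-cong-≗ (λ k → cong (λ x → f k * δ x r) (⊙-assoc c d k)) ⟩
    ∑[ k < n ] (f k * δ (c ⊙ d ⊙ k) r)                        ≡⟨ sum-cong-≗ (λ k → ∑-sift (f k) (d ⊙ k) (λ m → δ (c ⊙ m) r)) ⟨
    ∑[ k < n ] ∑[ m < n ] (f k * δ (d ⊙ k) m * δ (c ⊙ m) r)   ≡⟨ ∑-comm (λ k m → f k * δ (d ⊙ k) m * δ (c ⊙ m) r) ⟩
    ∑[ m < n ] ∑[ k < n ] (f k * δ (d ⊙ k) m * δ (c ⊙ m) r)   ≡⟨ sum-cong-≗ (λ m → *-distribʳ-sum (δ (c ⊙ m) r) (λ k → f k * δ (d ⊙ k) m)) ⟨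
    ∑[ m < n ] (dil d f m * δ (c ⊙ m) r)                      ∎
    where open ≡-Reasoning

  mass-dil : ∀ c f → mass (dil c f) ≡ mass f
  mass-dil c f = begin
    ∑[ r < n ] ∑[ k < n ] (f k * δ (c ⊙ k) r)  ≡⟨ ∑-comm (λ r k → f k * δ (c ⊙ k) r) ⟩
    ∑[ k < n ] ∑[ r < n ] (f k * δ (c ⊙ k) r)  ≡⟨ sum-cong-≗ (λ k → trans (sym (*-distribˡ-sum (f k) (δ (c ⊙ k))))
                                                                         (trans (cong (f k *_) (∑-δ (c ⊙ k))) (*-identityʳ (f k)))) ⟩
    mass f                                     ∎
    where open ≡-Reasoning

nC0≡1 : ∀ m → m C 0 ≡ 1
nC0≡1 zero    = refl
nC0≡1 (suc m) = refl

[k+1]*[m+1]C[k+1]≡[m+1]*mCk : ∀ m k → suc k * (suc m C suc k) ≡ suc m * (m C k)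
[k+1]*[m+1]C[k+1]≡[m+1]*mCk zero    zero    = refl
[k+1]*[m+1]C[k+1]≡[m+1]*mCk zero    (suc k) = *-zeroʳ (suc (suc k))
[k+1]*[m+1]C[k+1]≡[m+1]*mCk (suc m) zero    = begin
  1 * (suc (suc m) C 1)      ≡⟨ *-identityˡ _ ⟩
  suc (suc m) C 1            ≡⟨ nCk+nC[k+1]≡[n+1]C[k+1] (suc m) 0 ⟨
  1 + suc m C 1              ≡⟨ cong (1 +_) (trans (sym (*-identityˡ _)) ([k+1]*[m+1]C[k+1]≡[m+1]*mCk m 0)) ⟩
  1 + suc m * (m C 0)        ≡⟨ cong (λ x → 1 + suc m * x) (nC0≡1 m) ⟩
  suc (suc m * 1)            ≡⟨ cong suc (trans (*-identityʳ (suc m)) (sym (*-identityʳ (suc m)))) ⟩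
  suc (suc m) * 1            ∎
  where open ≡-Reasoning
[k+1]*[m+1]C[k+1]≡[m+1]*mCk (suc m) (suc k) = begin
  suc (suc k) * (suc (suc m) C suc (suc k))
    ≡⟨ cong (suc (suc k) *_) (nCk+nC[k+1]≡[n+1]C[k+1] (suc m) (suc k)) ⟨
  suc (suc k) * (suc m C suc k + suc m C suc (suc k))
    ≡⟨ *-distribˡ-+ (suc (suc k)) (suc m C suc k) _ ⟩
  suc (suc k) * (suc m C suc k) + suc (suc k) * (suc m C suc (suc k))
    ≡⟨ cong₂ (λ x y → suc m C suc k + x + y) ([k+1]*[m+1]C[k+1]≡[m+1]*mCk m k) ([k+1]*[m+1]C[k+1]≡[m+1]*mCk m (suc k)) ⟩
  suc m C suc k + suc m * (m C k) + suc m * (m C suc k)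
    ≡⟨ +-assoc (suc m C suc k) _ _ ⟩
  suc m C suc k + (suc m * (m C k) + suc m * (m C suc k))
    ≡⟨ cong (suc m C suc k +_) (sym (*-distribˡ-+ (suc m) (m C k) (m C suc k))) ⟩
  suc m C suc k + suc m * (m C k + m C suc k)
    ≡⟨ cong (λ x → suc m C suc k + suc m * x) (nCk+nC[k+1]≡[n+1]C[k+1] m k) ⟩
  suc (suc m) * (suc m C suc k)
    ∎
  where open ≡-Reasoning

prime∣pCk : ∀ {p} → Prime p → ∀ {k} → 0 < k → k < p → p ∣ p C k
prime∣pCk {suc m} p-prime {suc k} _ k<p = coprime-divisor (prime⇒coprime p-prime k<p)
  (divides (m C k) (trans ([k+1]*[m+1]C[k+1]≡[m+1]*mCk m k) (*-comm (suc m) (m C k))))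

prime∣x^[m+1]⇒prime∣x : ∀ {p} → Prime p → ∀ m x → p ∣ x ^ suc m → p ∣ x
prime∣x^[m+1]⇒prime∣x p-prime zero    x p∣x^1 = subst (_ ∣_) (*-identityʳ x) p∣x^1
prime∣x^[m+1]⇒prime∣x p-prime (suc m) x p∣x^m+2 with euclidsLemma x (x ^ suc m) p-prime p∣x^m+2
... | inj₁ p∣x     = p∣x
... | inj₂ p∣x^m+1 = prime∣x^[m+1]⇒prime∣x p-prime m x p∣x^m+1

module Frobenius (n : ℕ) .{{_ : NonZero n}} where

  open +-*-Solver using (solve; _:*_; _:+_; _:=_)

  open Mod n
  open GroupSemiring n
  open RawSemiring (Semiring.rawSemiring ℕ[ℤ/n]) public using () renaming (_^_ to _^ᶠ_; _×_ to _×ᶠ_; sum to ∑ᶠ)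

  ∑ᶠ-apply : ∀ {m} (t : Fin m → Fn) r → ∑ᶠ t r ≡ ∑[ k < m ] t k r
  ∑ᶠ-apply {zero}  t r = refl
  ∑ᶠ-apply {suc m} t r = cong (t zero r +_) (∑ᶠ-apply (t ∘ suc) r)

  ×ᶠ-apply : ∀ m f r → (m ×ᶠ f) r ≡ m * f r
  ×ᶠ-apply zero    f r = refl
  ×ᶠ-apply (suc m) f r = cong (f r +_) (×ᶠ-apply m f r)

  ^ᶠ-cong : ∀ m {f g} → f ≋ g → f ^ᶠ m ≋ g ^ᶠ m
  ^ᶠ-cong zero    f≋g r = refl
  ^ᶠ-cong (suc m) f≋g   = ∗-cong f≋g (^ᶠ-cong m f≋g)

  δ-^ᶠ : ∀ m a → δ a ^ᶠ m ≋ δ (m ⊙ a)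
  δ-^ᶠ zero    a r = refl
  δ-^ᶠ (suc m) a r = begin
    (δ a ∗ δ a ^ᶠ m) r      ≡⟨ ∗-cong {δ a} (λ _ → refl) (δ-^ᶠ m a) r ⟩
    (δ a ∗ δ (m ⊙ a)) r     ≡⟨ δ-∗-δ a (m ⊙ a) r ⟩
    δ (a ⊕ m ⊙ a) r         ≡⟨ cong (λ x → δ x r) (suc-⊙ m a) ⟨
    δ (suc m ⊙ a) r         ∎
    where open ≡-Reasoning

  mass-^ᶠ : ∀ m f → mass (f ^ᶠ m) ≡ mass f ^ m
  mass-^ᶠ zero    f = ∑-δ 0̂
  mass-^ᶠ (suc m) f = trans (mass-∗ f (f ^ᶠ m)) (cong (mass f *_) (mass-^ᶠ m f))

  Frobenius : ℕ → Fn → Set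
  Frobenius p g = ∀ r → ∃ λ t → (g ^ᶠ p) r ≡ dil p g r + p * t

  module _ (q : ℕ) (p-prime : Prime (suc (suc q))) where

    private
      p : ℕ
      p = suc (suc q)

    freshmans-dream : ∀ x y r → ∃ λ t → ((x +ᶠ y) ^ᶠ p) r ≡ (y ^ᶠ p) r + (x ^ᶠ p) r + p * t
    freshmans-dream x y r = t , (begin
      ((x +ᶠ y) ^ᶠ p) r                                                ≡⟨ theorem (∗-comm x y) p r ⟩
      binomialExpansion p r                                            ≡⟨ ∑ᶠ-apply (binomialTerm p) r ⟩
      term zero + ∑[ k < suc (suc q) ] term (suc k)                    ≡⟨ cong (term zero +_) (sum-init-last (term ∘ suc)) ⟩
      term zero + (∑[ k < suc q ] term (suc (inject₁ k)) + term last)  ≡⟨ cong₂ (λ u v → term zero + (u + v)) ∑middle≡t*p term-last ⟩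
      term zero + (t * p + (x ^ᶠ p) r)                                 ≡⟨ cong (λ u → u + (t * p + (x ^ᶠ p) r)) term-first ⟩
      (y ^ᶠ p) r + (t * p + (x ^ᶠ p) r)                                ≡⟨ a+[b*c+d]≡a+d+c*b ((y ^ᶠ p) r) t p ((x ^ᶠ p) r) ⟩
      (y ^ᶠ p) r + (x ^ᶠ p) r + p * t                                  ∎)
      where
      open ≡-Reasoning
      open Binomial ℕ[ℤ/n] x y using (theorem; binomialExpansion; binomialTerm)
      last : Fin (suc p)
      last = suc (fromℕ (suc q))
      term : Fin (suc p) → ℕ
      term k = binomialTerm p k r
      term-apply : ∀ k → term k ≡ (p C toℕ k) * ((x ^ᶠ toℕ k) ∗ (y ^ᶠ (p ∸ toℕ k))) r
      term-apply k = ×ᶠ-apply (p C toℕ k) _ r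
      term-first : term zero ≡ (y ^ᶠ p) r
      term-first = trans (term-apply zero) (trans (*-identityˡ _) (∗-identityˡ (y ^ᶠ p) r))
      term-last : term last ≡ (x ^ᶠ p) r
      term-last = trans (term-apply last) (trans (cong (λ i → (p C i) * ((x ^ᶠ i) ∗ (y ^ᶠ (p ∸ i))) r) toℕ-last)
                  (trans (cong₂ (λ c i → c * ((x ^ᶠ p) ∗ (y ^ᶠ i)) r) (nCn≡1 p) (n∸n≡0 p))
                  (trans (*-identityˡ _) (∗-identityʳ (x ^ᶠ p) r))))
        where
        toℕ-last : toℕ last ≡ p
        toℕ-last = cong suc (Finₚ.toℕ-fromℕ (suc q))
      middle-divisible : ∀ k → p ∣ term (suc (inject₁ k))
      middle-divisible k = subst (p ∣_) (sym (term-apply (suc (inject₁ k))))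
        (∣m⇒∣m*n _ (prime∣pCk p-prime (s≤s z≤n) (s≤s (subst (_< suc q) (sym (Finₚ.toℕ-inject₁ k)) (Finₚ.toℕ<n k)))))
      open _∣_ (∣-∑ p (λ k → term (suc (inject₁ k))) middle-divisible) renaming (quotient to t; equality to ∑middle≡t*p)
      a+[b*c+d]≡a+d+c*b : ∀ a b c d → a + (b * c + d) ≡ a + d + c * b
      a+[b*c+d]≡a+d+c*b = solve 4 (λ a b c d → a :+ (b :* c :+ d) := a :+ d :+ c :* b) refl

    frobenius-cong : ∀ {f g} → f ≋ g → Frobenius p f → Frobenius p g
    frobenius-cong f≋g frob-f r with frob-f r
    ... | t , eq = t , trans (sym (^ᶠ-cong p f≋g r)) (trans eq (cong (_+ p * t) (dil-cong p f≋g r)))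

    frobenius-0ᶠ : Frobenius p 0ᶠ
    frobenius-0ᶠ r = 0 , trans (∗-zeroˡ (0ᶠ ^ᶠ suc q) r)
      (sym (cong₂ _+_ (∑-zero n) (*-zeroʳ p)))

    frobenius-δ : ∀ a → Frobenius p (δ a)
    frobenius-δ a r = 0 , trans (δ-^ᶠ p a r)
      (sym (trans (cong (dil p (δ a) r +_) (*-zeroʳ p)) (trans (+-identityʳ _) (dil-δ p a r))))

    frobenius-+ᶠ : ∀ {f g} → Frobenius p f → Frobenius p g → Frobenius p (f +ᶠ g)
    frobenius-+ᶠ {f} {g} frob-f frob-g r = tg + tf + t , (begin
      ((f +ᶠ g) ^ᶠ p) r                                        ≡⟨ eq ⟩
      (g ^ᶠ p) r + (f ^ᶠ p) r + p * t                          ≡⟨ cong₂ (λ u v → u + v + p * t) eqg eqf ⟩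
      dil p g r + p * tg + (dil p f r + p * tf) + p * t        ≡⟨ regroup (dil p f r) (dil p g r) p tf tg t ⟩
      dil p f r + dil p g r + p * (tg + tf + t)                ≡⟨ cong (_+ p * (tg + tf + t)) (dil-+ᶠ p f g r) ⟨
      dil p (f +ᶠ g) r + p * (tg + tf + t)                     ∎)
      where
      open ≡-Reasoning
      tf tg t : ℕ
      tf = proj₁ (frob-f r)
      tg = proj₁ (frob-g r)
      t  = proj₁ (freshmans-dream f g r)
      eqf : (f ^ᶠ p) r ≡ dil p f r + p * tf
      eqf = proj₂ (frob-f r)
      eqg : (g ^ᶠ p) r ≡ dil p g r + p * tg
      eqg = proj₂ (frob-g r)
      eq : ((f +ᶠ g) ^ᶠ p) r ≡ (g ^ᶠ p) r + (f ^ᶠ p) r + p * t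
      eq = proj₂ (freshmans-dream f g r)
      regroup : ∀ a b c d e h → b + c * e + (a + c * d) + c * h ≡ a + b + c * (e + d + h)
      regroup = solve 6 (λ a b c d e h → b :+ c :* e :+ (a :+ c :* d) :+ c :* h := a :+ b :+ c :* (e :+ d :+ h)) refl

    frobenius-scale : ∀ c {f} → Frobenius p f → Frobenius p (λ r → c * f r)
    frobenius-scale zero    frob-f = frobenius-0ᶠ
    frobenius-scale (suc c) {f} frob-f = frobenius-+ᶠ {f} {λ r → c * f r} frob-f (frobenius-scale c frob-f)

    frobenius-∑ : ∀ {m} (F : Fin m → Fn) → (∀ a → Frobenius p (F a)) → Frobenius p (λ r → ∑[ a < m ] F a r)
    frobenius-∑ {zero}  F frob-F = frobenius-0ᶠ
    frobenius-∑ {suc m} F frob-F =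
      frobenius-+ᶠ {F zero} {λ r → ∑[ a < m ] F (suc a) r} (frob-F zero) (frobenius-∑ (F ∘ suc) (frob-F ∘ suc))

    frobenius : ∀ g → Frobenius p g
    frobenius g = frobenius-cong (λ r → ∑-δʳ r g)
      (frobenius-∑ (λ a r → g a * δ a r) (λ a → frobenius-scale (g a) (frobenius-δ a)))

module Tijdeman (n : ℕ) .{{_ : NonZero n}} where

  open GroupSemiring n
  open Frobenius n

  module _ (q : ℕ) (p-prime : Prime (suc (suc q))) where

    private
      p : ℕ
      p = suc (suc q)

    tijdeman-prime : ∀ {A B} → A ∗ B ≋ const 1 → ¬ p ∣ mass B → A ∗ dil p B ≋ const 1
    tijdeman-prime {A} {B} A∗B≋1 p∤mass-B r = sym (∑-≥⇒≗ {f = const 1} positive (≤-reflexive masses-equal) r)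
      where
      open ≡-Reasoning
      t : Fn
      t = proj₁ ∘ frobenius q p-prime B
      A∗Bᵖ≡power : ∀ r → (A ∗ B ^ᶠ p) r ≡ mass B ^ suc q
      A∗Bᵖ≡power r = begin
        (A ∗ (B ∗ B ^ᶠ suc q)) r   ≡⟨ ∗-assoc A B (B ^ᶠ suc q) r ⟨
        ((A ∗ B) ∗ B ^ᶠ suc q) r   ≡⟨ ∗-constˡ 1 (A ∗ B) (B ^ᶠ suc q) A∗B≋1 r ⟩
        1 * mass (B ^ᶠ suc q)      ≡⟨ *-identityˡ _ ⟩
        mass (B ^ᶠ suc q)          ≡⟨ mass-^ᶠ (suc q) B ⟩
        mass B ^ suc q             ∎
      A∗Bᵖ≡dil : ∀ r → (A ∗ B ^ᶠ p) r ≡ (A ∗ dil p B) r + p * (A ∗ t) r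
      A∗Bᵖ≡dil r = begin
        (A ∗ B ^ᶠ p) r                              ≡⟨ ∗-cong {A} (λ _ → refl) (proj₂ ∘ frobenius q p-prime B) r ⟩
        (A ∗ (dil p B +ᶠ (λ k → p * t k))) r        ≡⟨ ∗-distribˡ-+ᶠ A (dil p B) _ r ⟩
        (A ∗ dil p B) r + (A ∗ (λ k → p * t k)) r   ≡⟨ cong ((A ∗ dil p B) r +_) (∗-*ʳ p A t r) ⟩
        (A ∗ dil p B) r + p * (A ∗ t) r             ∎
      positive : ∀ r → 1 ≤ (A ∗ dil p B) r
      positive r = nonzero ((A ∗ dil p B) r) {(A ∗ t) r} (trans (sym (A∗Bᵖ≡dil r)) (A∗Bᵖ≡power r))
        where
        nonzero : ∀ x {y} → x + p * y ≡ mass B ^ suc q → 1 ≤ x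
        nonzero (suc x) _  = s≤s z≤n
        nonzero zero {y} eq = ⊥-elim (p∤mass-B (prime∣x^[m+1]⇒prime∣x p-prime q (mass B) (divides y (trans (sym eq) (*-comm p y)))))
      masses-equal : mass (A ∗ dil p B) ≡ ∑[ r < n ] 1
      masses-equal = begin
        mass (A ∗ dil p B)        ≡⟨ mass-∗ A (dil p B) ⟩
        mass A * mass (dil p B)   ≡⟨ cong (mass A *_) (mass-dil p B) ⟩
        mass A * mass B           ≡⟨ mass-∗ A B ⟨
        mass (A ∗ B)              ≡⟨ sum-cong-≗ A∗B≋1 ⟩
        ∑[ r < n ] 1              ∎

  tijdeman-∏ : ∀ {A B} fs → All Prime fs → Coprime (product fs) (mass B) → A ∗ B ≋ const 1 → A ∗ dil (product fs) B ≋ const 1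
  tijdeman-∏ {A} {B} [] _ _ A∗B≋1 r = trans (∗-cong {A} (λ _ → refl) (dil-identity B) r) (A∗B≋1 r)
  tijdeman-∏ {A} {B} (suc (suc q) ∷ fs) (p-prime ∷ fs-prime) coprime A∗B≋1 r = begin
    (A ∗ dil (p * product fs) B) r
      ≡⟨ ∗-cong {A} (λ _ → refl) (dil-* p (product fs) B) r ⟩
    (A ∗ dil p (dil (product fs) B)) r
      ≡⟨ tijdeman-prime q p-prime {A} {dil (product fs) B} (tijdeman-∏ {A} {B} fs fs-prime coprime-rest A∗B≋1) p∤mass r ⟩
    1
      ∎
    where
    open ≡-Reasoning
    p : ℕ
    p = suc (suc q)
    coprime-rest : Coprime (product fs) (mass B)
    coprime-rest (d∣∏ , d∣mass) = coprime (∣n⇒∣m*n p d∣∏ , d∣mass)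
    p∤mass : ¬ p ∣ mass (dil (product fs) B)
    p∤mass p∣mass = ¬prime[1] (subst Prime (coprime (m∣m*n (product fs) , subst (p ∣_) (mass-dil (product fs) B) p∣mass)) p-prime)

  tijdeman : ∀ {A B} D .{{_ : NonZero D}} → Coprime D (mass B) → A ∗ B ≋ const 1 → A ∗ dil D B ≋ const 1
  tijdeman {A} {B} D coprime A∗B≋1 r = trans (cong (λ d → (A ∗ dil d B) r) isFactorisation)
    (tijdeman-∏ {A} {B} factors factorsPrime (subst (λ d → Coprime d (mass B)) isFactorisation coprime) A∗B≋1 r)
    where open PrimeFactorisation (factorise D)

module Matrices (n : ℕ) .{{_ : NonZero n}} where

  open +-*-Solver using (solve; _:*_; _:=_)

  open Mod n using (_⊕_; _⊙_)
  open GroupSemiring n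

  infix 4 _≈_
  infixl 7 _∘⟨_⟩_

  Mat : Set
  Mat = Fin n → Fin n → ℕ

  _≈_ : ∀ {I J : Set} → (I → J → ℕ) → (I → J → ℕ) → Set
  M ≈ N = ∀ i j → M i j ≡ N i j

  ≈-refl : ∀ {I J : Set} {M : I → J → ℕ} → M ≈ M
  ≈-refl i j = refl

  ≈-sym : ∀ {I J : Set} {M N : I → J → ℕ} → M ≈ N → N ≈ M
  ≈-sym M≈N i j = sym (M≈N i j)

  ≈-trans : ∀ {I J : Set} {M N K : I → J → ℕ} → M ≈ N → N ≈ K → M ≈ K
  ≈-trans M≈N N≈K i j = trans (M≈N i j) (N≈K i j)

  -- (M ∘⟨ r ⟩ N) i l counts, with multiplicities, the pairs a^i b a^j ∈ M, a^k b a^l ∈ N with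
  -- j + k ≡ r: the multiset form of compose.  Rows and columns range over arbitrary types so that
  -- P and Q can enter as a row and a column.
  _∘⟨_⟩_ : ∀ {I J : Set} → (I → Fin n → ℕ) → Fin n → (Fin n → J → ℕ) → I → J → ℕ
  (M ∘⟨ r ⟩ N) i l = (M i ∗ λ k → N k l) r

  ∘-cong : ∀ {I J : Set} {M M′ : I → Fin n → ℕ} {N N′ : Fin n → J → ℕ} r → M ≈ M′ → N ≈ N′ → M ∘⟨ r ⟩ N ≈ M′ ∘⟨ r ⟩ N′
  ∘-cong r M≈M′ N≈N′ i l = ∗-cong (M≈M′ i) (λ k → N≈N′ k l) r

  ∘-assoc : ∀ {I J : Set} (M : I → Fin n → ℕ) r (N : Mat) s (K : Fin n → J → ℕ) →
            M ∘⟨ r ⟩ N ∘⟨ s ⟩ K ≈ M ∘⟨ r ⟩ (N ∘⟨ s ⟩ K)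
  ∘-assoc M r N s K i l = begin
    ∑[ a < n ] ∑[ c < n ] ((M ∘⟨ r ⟩ N) i a * K c l * δ (a ⊕ c) s)
      ≡⟨ sum-cong-≗ (λ a → sum-cong-≗ λ c → ∑∑-*-* (λ j k → M i j * N k a * δ (j ⊕ k) r) (K c l) (δ (a ⊕ c) s)) ⟩
    ∑[ a < n ] ∑[ c < n ] ∑[ j < n ] ∑[ k < n ] (M i j * N k a * δ (j ⊕ k) r * K c l * δ (a ⊕ c) s)
      ≡⟨ ∑-comm₂₂ (λ a c j k → M i j * N k a * δ (j ⊕ k) r * K c l * δ (a ⊕ c) s) ⟩
    ∑[ j < n ] ∑[ k < n ] ∑[ a < n ] ∑[ c < n ] (M i j * N k a * δ (j ⊕ k) r * K c l * δ (a ⊕ c) s)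
      ≡⟨ sum-cong-≗ (λ j → sum-cong-≗ λ k → sum-cong-≗ λ a → sum-cong-≗ λ c →
           rearrange (M i j) (N k a) (δ (j ⊕ k) r) (K c l) (δ (a ⊕ c) s)) ⟩
    ∑[ j < n ] ∑[ k < n ] ∑[ a < n ] ∑[ c < n ] (M i j * (N k a * K c l * δ (a ⊕ c) s) * δ (j ⊕ k) r)
      ≡⟨ sum-cong-≗ (λ j → sum-cong-≗ λ k → *-∑∑-* (M i j) (λ a c → N k a * K c l * δ (a ⊕ c) s) (δ (j ⊕ k) r)) ⟨
    ∑[ j < n ] ∑[ k < n ] (M i j * (N ∘⟨ s ⟩ K) k l * δ (j ⊕ k) r)
      ∎
    where
    open ≡-Reasoning
    rearrange : ∀ x y z u v → x * y * z * u * v ≡ x * (y * u * v) * z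
    rearrange = solve 5 (λ x y z u v → x :* y :* z :* u :* v := x :* (y :* u :* v) :* z) refl

  infix 10 _ᵀ

  _ᵀ : ∀ {I J : Set} → (I → J → ℕ) → J → I → ℕ
  (M ᵀ) j i = M i j

  ∘-ᵀ : ∀ {I J : Set} (M : I → Fin n → ℕ) r (N : Fin n → J → ℕ) → (M ∘⟨ r ⟩ N) ᵀ ≈ N ᵀ ∘⟨ r ⟩ M ᵀ
  ∘-ᵀ M r N l i = ∗-comm (M i) (λ k → N k l) r

  leftDil : ∀ {J : Set} → ℕ → (Fin n → J → ℕ) → Fin n → J → ℕ
  leftDil c M k′ l = dil c (λ k → M k l) k′

  rightDil : ∀ {I : Set} → ℕ → (I → Fin n → ℕ) → I → Fin n → ℕ
  rightDil c M i j′ = dil c (M i) j′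

  leftDil-∘ : ∀ {J : Set} c (M : Mat) s (N : Fin n → J → ℕ) → leftDil c M ∘⟨ s ⟩ N ≈ leftDil c (M ∘⟨ s ⟩ N)
  leftDil-∘ c M s N k′ l = begin
    ∑[ j < n ] ∑[ k < n ] (∑[ a < n ] (M a j * δ (c ⊙ a) k′) * N k l * δ (j ⊕ k) s)
      ≡⟨ sum-cong-≗ (λ j → sum-cong-≗ λ k → ∑-*-* (λ a → M a j * δ (c ⊙ a) k′) (N k l) (δ (j ⊕ k) s)) ⟩
    ∑[ j < n ] ∑[ k < n ] ∑[ a < n ] (M a j * δ (c ⊙ a) k′ * N k l * δ (j ⊕ k) s)
      ≡⟨ ∑-comm₃ (λ a j k → M a j * δ (c ⊙ a) k′ * N k l * δ (j ⊕ k) s) ⟨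
    ∑[ a < n ] ∑[ j < n ] ∑[ k < n ] (M a j * δ (c ⊙ a) k′ * N k l * δ (j ⊕ k) s)
      ≡⟨ sum-cong-≗ (λ a → sum-cong-≗ λ j → sum-cong-≗ λ k → rearrange (M a j) (δ (c ⊙ a) k′) (N k l) (δ (j ⊕ k) s)) ⟩
    ∑[ a < n ] ∑[ j < n ] ∑[ k < n ] (M a j * N k l * δ (j ⊕ k) s * δ (c ⊙ a) k′)
      ≡⟨ sum-cong-≗ (λ a → ∑∑-* (λ j k → M a j * N k l * δ (j ⊕ k) s) (δ (c ⊙ a) k′)) ⟨
    ∑[ a < n ] ((M ∘⟨ s ⟩ N) a l * δ (c ⊙ a) k′)
      ∎
    where
    open ≡-Reasoning
    rearrange : ∀ x y z u → x * y * z * u ≡ x * z * u * y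
    rearrange = solve 4 (λ x y z u → x :* y :* z :* u := x :* z :* u :* y) refl

  total : Mat → ℕ
  total M = ∑[ i < n ] ∑[ j < n ] M i j

  total-mono : ∀ {M N : Mat} → (∀ i j → M i j ≤ N i j) → total M ≤ total N
  total-mono M≤N = ∑-mono-≤ (λ i → ∑-mono-≤ (M≤N i))

  total-≥⇒≈ : ∀ {M N : Mat} → (∀ i j → M i j ≤ N i j) → total N ≤ total M → M ≈ N
  total-≥⇒≈ M≤N ∑N≤∑M i = ∑-≥⇒≗ (M≤N i) (≤-reflexive (sym (∑-≥⇒≗ (λ i → ∑-mono-≤ (M≤N i)) ∑N≤∑M i)))

  ∑-total-∘ : ∀ (M N : Mat) → ∑[ r < n ] total (M ∘⟨ r ⟩ N) ≡ total M * total N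
  ∑-total-∘ M N = begin
    ∑[ r < n ] ∑[ i < n ] ∑[ l < n ] (M i ∗ λ k → N k l) r    ≡⟨ ∑-comm₃ (λ r i l → (M i ∗ λ k → N k l) r) ⟩
    ∑[ i < n ] ∑[ l < n ] mass (M i ∗ λ k → N k l)            ≡⟨ sum-cong-≗ (λ i → trans (sum-cong-≗ λ l → mass-∗ (M i) (λ k → N k l))
                                                                                   (sym (*-distribˡ-sum (mass (M i)) (λ l → ∑[ k < n ] N k l)))) ⟩
    ∑[ i < n ] (mass (M i) * ∑[ l < n ] ∑[ k < n ] N k l)     ≡⟨ *-distribʳ-sum _ (λ i → mass (M i)) ⟨
    total M * ∑[ l < n ] ∑[ k < n ] N k l                    ≡⟨ cong (total M *_) (∑-comm (λ l k → N k l)) ⟩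
    total M * total N                                        ∎
    where open ≡-Reasoning

  data Chain (G : Mat → Set) : Set where
    [_]    : ∀ {M} → G M → Chain G
    _∷⟨_⟩_ : ∀ {M} → G M → Fin n → Chain G → Chain G

  infixr 5 _∷⟨_⟩_ _++⟨_⟩_

  value : ∀ {G} → Chain G → Mat
  value ([_] {M} _)        = M
  value (_∷⟨_⟩_ {M} _ r c) = M ∘⟨ r ⟩ value c

  _++⟨_⟩_ : ∀ {G} → Chain G → Fin n → Chain G → Chain G
  [ g ]        ++⟨ r ⟩ d = g ∷⟨ r ⟩ d
  (g ∷⟨ s ⟩ c) ++⟨ r ⟩ d = g ∷⟨ s ⟩ (c ++⟨ r ⟩ d)

  value-++ : ∀ {G} (c : Chain G) r (d : Chain G) → value (c ++⟨ r ⟩ d) ≈ value c ∘⟨ r ⟩ value d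
  value-++ [ g ]                    r d = ≈-refl
  value-++ (_∷⟨_⟩_ {M} g s c) r d =
    ≈-trans (∘-cong {M = M} s ≈-refl (value-++ c r d)) (≈-sym (∘-assoc M s (value c) r (value d)))

  mapChain : ∀ {G H : Mat → Set} → (∀ {M} → G M → H M) → Chain G → Chain H
  mapChain f [ g ]        = [ f g ]
  mapChain f (g ∷⟨ r ⟩ c) = f g ∷⟨ r ⟩ mapChain f c

  value-mapChain : ∀ {G H : Mat → Set} (f : ∀ {M} → G M → H M) (c : Chain G) → value (mapChain f c) ≡ value c
  value-mapChain f [ g ]                              = refl
  value-mapChain {G} {H} f (_∷⟨_⟩_ {M} g r c) = cong (λ (N : Mat) → M ∘⟨ r ⟩ N) (value-mapChain {G} {H} f c)

  reverse : ∀ {G} → Chain (λ M → G (M ᵀ)) → Chain G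
  reverse ([_] {M} g)        = [_] {M = M ᵀ} g
  reverse (_∷⟨_⟩_ {M} g r c) = reverse c ++⟨ r ⟩ [_] {M = M ᵀ} g

  value-reverse : ∀ {G} (c : Chain (λ M → G (M ᵀ))) → value (reverse {G} c) ≈ value c ᵀ
  value-reverse [ g ]                   = ≈-refl
  value-reverse {G} (_∷⟨_⟩_ {M} g r c) =
    ≈-trans (value-++ {G} (reverse c) r ([_] {G} {M ᵀ} g))
            (≈-trans (∘-cong {N = M ᵀ} r (value-reverse {G} c) ≈-refl) (≈-sym (∘-ᵀ M r (value c))))

module Bordering (n : ℕ) .{{_ : NonZero n}} (Ph Qh : Fin n → ℕ) where

  open Mod n using (_⊕_; _⊙_)
  open GroupSemiring n
  open Tijdeman n using (tijdeman)
  open Matrices n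

  P̂ : ⊤ → Fin n → ℕ
  P̂ _ = Ph

  Q̂ : Fin n → ⊤ → ℕ
  Q̂ k _ = Qh k

  leftBorder : Mat → Fin n → Fn
  leftBorder M u y = (P̂ ∘⟨ u ⟩ M) tt y

  rightBorder : Mat → Fin n → Fn
  rightBorder M v x = (M ∘⟨ v ⟩ Q̂) x tt

  -- The coefficient of a^u b a^v in a^P M a^Q, exponents read modulo n.
  border : Mat → Fin n → Fin n → ℕ
  border M u v = (P̂ ∘⟨ u ⟩ (M ∘⟨ v ⟩ Q̂)) tt tt

  Bordered : Mat → Set
  Bordered M = ∀ u v → border M u v ≡ 1

  bordered-cong : ∀ {M N} → M ≈ N → Bordered M → Bordered N
  bordered-cong {M} {N} M≈N M-bordered u v =
    trans (sym (∘-cong {M = P̂} u ≈-refl (∘-cong {N = Q̂} v M≈N ≈-refl) tt tt)) (M-bordered u v)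

  border-∘ : ∀ U r Y u v → border (U ∘⟨ r ⟩ Y) u v ≡ (leftBorder U u ∗ rightBorder Y v) r
  border-∘ U r Y u v = trans (∘-cong {M = P̂} u ≈-refl (∘-assoc U r Y v Q̂) tt tt)
                             (sym (∘-assoc P̂ u U r (Y ∘⟨ v ⟩ Q̂) tt tt))

  border≡leftBorder∗Qh : ∀ M u v → border M u v ≡ (leftBorder M u ∗ Qh) v
  border≡leftBorder∗Qh M u v = sym (∘-assoc P̂ u M v Q̂ tt tt)

  rightBorder-leftDil : ∀ c M v → rightBorder (leftDil c M) v ≋ dil c (rightBorder M v)
  rightBorder-leftDil c M v x = leftDil-∘ c M v Q̂ x tt

  ∑-border : ∀ M v → ∑[ u < n ] border M u v ≡ mass Ph * mass (rightBorder M v)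
  ∑-border M v = mass-∗ Ph (rightBorder M v)

  ∑-rightBorder : ∀ M → ∑[ v < n ] mass (rightBorder M v) ≡ total M * mass Qh
  ∑-rightBorder M = begin
    ∑[ v < n ] ∑[ x < n ] (M x ∗ Qh) v   ≡⟨ ∑-comm (λ v x → (M x ∗ Qh) v) ⟩
    ∑[ x < n ] mass (M x ∗ Qh)           ≡⟨ sum-cong-≗ (λ x → mass-∗ (M x) Qh) ⟩
    ∑[ x < n ] (mass (M x) * mass Qh)    ≡⟨ *-distribʳ-sum (mass Qh) (λ x → mass (M x)) ⟨
    total M * mass Qh                    ∎
    where open ≡-Reasoning

  ∑∑-border : ∀ M → ∑[ u < n ] ∑[ v < n ] border M u v ≡ mass Ph * mass Qh * total M
  ∑∑-border M = begin
    ∑[ u < n ] ∑[ v < n ] border M u v             ≡⟨ ∑-comm (λ u v → border M u v) ⟩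
    ∑[ v < n ] ∑[ u < n ] border M u v             ≡⟨ sum-cong-≗ (∑-border M) ⟩
    ∑[ v < n ] (mass Ph * mass (rightBorder M v))  ≡⟨ *-distribˡ-sum (mass Ph) (λ v → mass (rightBorder M v)) ⟨
    mass Ph * ∑[ v < n ] mass (rightBorder M v)    ≡⟨ cong (mass Ph *_) (∑-rightBorder M) ⟩
    mass Ph * (total M * mass Qh)                  ≡⟨ cong (mass Ph *_) (*-comm (total M) (mass Qh)) ⟩
    mass Ph * (mass Qh * total M)                  ≡⟨ *-assoc (mass Ph) (mass Qh) (total M) ⟨
    mass Ph * mass Qh * total M                    ∎
    where open ≡-Reasoning

  ∑∑-bordered : ∀ {M} → Bordered M → ∑[ u < n ] ∑[ v < n ] border M u v ≡ n * n
  ∑∑-bordered M-bordered = trans (sum-cong-≗ λ u → trans (sum-cong-≗ (M-bordered u)) (trans (∑-const n 1) (*-identityʳ n)))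
                                 (∑-const n n)

  bordered⇒mass-product : ∀ {M} → Bordered M → total M ≡ n → mass Ph * mass Qh ≡ n
  bordered⇒mass-product {M} M-bordered total≡n = *-cancelʳ-≡ (mass Ph * mass Qh) n n
    (trans (cong (mass Ph * mass Qh *_) (sym total≡n)) (trans (sym (∑∑-border M)) (∑∑-bordered {M} M-bordered)))

  bordered⇒≤1 : 1 ≤ mass Ph → 1 ≤ mass Qh → ∀ {M} → Bordered M → ∀ x y → M x y ≤ 1
  bordered⇒≤1 Ph≥1 Qh≥1 {M} M-bordered x y with ∑-positive Ph Ph≥1 | ∑-positive Qh Qh≥1
  ... | a , Ph-a≥1 | l , Qh-l≥1 = begin
    M x y                                              ≤⟨ m≤m*n (M x y) (Qh l) {{>-nonZero Qh-l≥1}} ⟩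
    M x y * Qh l                                       ≡⟨ *-identityʳ _ ⟨
    M x y * Qh l * 1                                   ≡⟨ cong (M x y * Qh l *_) (δ-refl (y ⊕ l)) ⟨
    M x y * Qh l * δ (y ⊕ l) (y ⊕ l)                   ≤⟨ term≤∑∑ (λ y′ l′ → M x y′ * Qh l′ * δ (y′ ⊕ l′) (y ⊕ l)) y l ⟩
    rightBorder M (y ⊕ l) x                            ≤⟨ m≤n*m _ (Ph a) {{>-nonZero Ph-a≥1}} ⟩
    Ph a * rightBorder M (y ⊕ l) x                     ≡⟨ *-identityʳ _ ⟨
    Ph a * rightBorder M (y ⊕ l) x * 1                 ≡⟨ cong (Ph a * rightBorder M (y ⊕ l) x *_) (δ-refl (a ⊕ x)) ⟨
    Ph a * rightBorder M (y ⊕ l) x * δ (a ⊕ x) (a ⊕ x) ≤⟨ term≤∑∑ (λ a′ x′ → Ph a′ * rightBorder M (y ⊕ l) x′ * δ (a′ ⊕ x′) (a ⊕ x)) a x ⟩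
    border M (a ⊕ x) (y ⊕ l)                           ≡⟨ M-bordered (a ⊕ x) (y ⊕ l) ⟩
    1                                                  ∎
    where open ≤-Reasoning

  Good : (Mat → Set) → Set
  Good G = ∀ (c : Chain G) → Bordered (value c)

  good-mono : ∀ {G H : Mat → Set} → (∀ {M} → H M → G M) → Good G → Good H
  good-mono H⊆G G-good c = subst Bordered (value-mapChain H⊆G c) (G-good (mapChain H⊆G c))

  -- Tijdeman's lemma handles a left dilation only through leftBorder U u for all prefixes U,
  -- so the induction over chains in good-∪-leftDil carries this invariant.
  LeftRobust : (Mat → Set) → Mat → Set
  LeftRobust G Y = Bordered Y × (∀ (c : Chain G) r → Bordered (value c ∘⟨ r ⟩ Y))

  leftRobust-cong : ∀ {G Y Y′} → Y ≈ Y′ → LeftRobust G Y → LeftRobust G Y′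
  leftRobust-cong {Y = Y} Y≈Y′ (Y-bordered , ∘Y-bordered) =
    bordered-cong Y≈Y′ Y-bordered , λ c r → bordered-cong (∘-cong {M = value c} {N = Y} r ≈-refl Y≈Y′) (∘Y-bordered c r)

  member-leftRobust : ∀ {G M} → Good G → G M → LeftRobust G M
  member-leftRobust {G} {M} G-good g = G-good [ g ] , λ c r → bordered-cong (value-++ c r [ g ]) (G-good (c ++⟨ r ⟩ [ g ]))

  leftRobust-∘ : ∀ {G M Y} → G M → ∀ s → LeftRobust G Y → LeftRobust G (M ∘⟨ s ⟩ Y)
  leftRobust-∘ {G} {M} {Y} g s (_ , ∘Y-bordered) = ∘Y-bordered [ g ] s , λ c r →
    bordered-cong (≈-trans (∘-cong {N = Y} s (value-++ c r [ g ]) ≈-refl) (∘-assoc (value c) r M s Y))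
                  (∘Y-bordered (c ++⟨ r ⟩ [ g ]) s)

  infixl 5 _∪≈_

  _∪≈_ : (Mat → Set) → Mat → Mat → Set
  (G ∪≈ X) M = G M ⊎ M ≈ X

  module _ (hPQ : mass Ph * mass Qh ≡ n) where

    instance
      mass-Ph-nonZero : NonZero (mass Ph)
      mass-Ph-nonZero = ≢-nonZero (λ mass-Ph≡0 → ≢-nonZero⁻¹ n (trans (sym hPQ) (cong (_* mass Qh) mass-Ph≡0)))

    mass-rightBorder : ∀ {Y} → Bordered Y → ∀ v → mass (rightBorder Y v) ≡ mass Qh
    mass-rightBorder {Y} Y-bordered v = *-cancelˡ-≡ (mass (rightBorder Y v)) (mass Qh) (mass Ph)
      (trans (sym (∑-border Y v)) (trans (sum-cong-≗ (λ u → Y-bordered u v)) (trans (∑-const n 1) (trans (*-identityʳ n) (sym hPQ)))))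

    bordered⇒total≡n : ∀ {M} → Bordered M → total M ≡ n
    bordered⇒total≡n {M} M-bordered = *-cancelˡ-≡ (total M) n n
      (trans (cong (_* total M) (sym hPQ)) (trans (sym (∑∑-border M)) (∑∑-bordered {M} M-bordered)))

    module _ (D : ℕ) .{{_ : NonZero D}} (coprime : Coprime D (mass Qh)) where

      coprime-rightBorder : ∀ {Y} → Bordered Y → ∀ v → Coprime D (mass (rightBorder Y v))
      coprime-rightBorder {Y} Y-bordered v = subst (Coprime D) (sym (mass-rightBorder {Y} Y-bordered v)) coprime

      bordered-leftDil : ∀ {Y} → Bordered Y → Bordered (leftDil D Y)
      bordered-leftDil {Y} Y-bordered u v = trans (∗-cong {Ph} (λ _ → refl) (rightBorder-leftDil D Y v) u)
        (tijdeman {Ph} {rightBorder Y v} D (coprime-rightBorder {Y} Y-bordered v) (λ u → Y-bordered u v) u)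

      bordered-∘-leftDil : ∀ {U Y} → Bordered Y → (∀ r → Bordered (U ∘⟨ r ⟩ Y)) → ∀ r → Bordered (U ∘⟨ r ⟩ leftDil D Y)
      bordered-∘-leftDil {U} {Y} Y-bordered U∘Y-bordered r u v = begin
        border (U ∘⟨ r ⟩ leftDil D Y) u v                  ≡⟨ border-∘ U r (leftDil D Y) u v ⟩
        (leftBorder U u ∗ rightBorder (leftDil D Y) v) r   ≡⟨ ∗-cong {leftBorder U u} (λ _ → refl) (rightBorder-leftDil D Y v) r ⟩
        (leftBorder U u ∗ dil D (rightBorder Y v)) r       ≡⟨ tijdeman {leftBorder U u} {rightBorder Y v} D (coprime-rightBorder {Y} Y-bordered v)
                                                                       (λ r′ → trans (sym (border-∘ U r′ Y u v)) (U∘Y-bordered r′ u v)) r ⟩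
        1                                                  ∎
        where open ≡-Reasoning

      leftRobust-leftDil : ∀ {G Y} → LeftRobust G Y → LeftRobust G (leftDil D Y)
      leftRobust-leftDil {Y = Y} (Y-bordered , ∘Y-bordered) =
        bordered-leftDil {Y} Y-bordered , λ c → bordered-∘-leftDil {value c} {Y} Y-bordered (∘Y-bordered c)

      good-∪-leftDil : ∀ {G X} → Good G → G X → Good (G ∪≈ leftDil D X)
      good-∪-leftDil {G} {X} G-good gX c = proj₁ (robust c)
        where
        robust : ∀ (c : Chain (G ∪≈ leftDil D X)) → LeftRobust G (value c)
        robust [ inj₁ g ]                      = member-leftRobust G-good g
        robust [ inj₂ M≈X′ ]                   = leftRobust-cong (≈-sym M≈X′) (leftRobust-leftDil (member-leftRobust G-good gX))
        robust (inj₁ g ∷⟨ s ⟩ c)               = leftRobust-∘ g s (robust c)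
        robust (_∷⟨_⟩_ {M} (inj₂ M≈X′) s c) = leftRobust-cong
          (≈-sym (≈-trans (∘-cong {N = value c} s M≈X′ ≈-refl) (leftDil-∘ D X s (value c))))
          (leftRobust-leftDil (leftRobust-∘ gX s (robust c)))

module Transposition (n : ℕ) .{{_ : NonZero n}} (Ph Qh : Fin n → ℕ) where

  open GroupSemiring n
  open Matrices n
  open Bordering n Ph Qh
  private module T = Bordering n Qh Ph

  border-ᵀ : ∀ M u v → T.border (M ᵀ) v u ≡ border M u v
  border-ᵀ M u v = begin
    (Qh ∗ T.rightBorder (M ᵀ) u) v   ≡⟨ ∗-cong {Qh} (λ _ → refl) (λ y → ∗-comm (λ x → M x y) Ph u) v ⟩
    (Qh ∗ leftBorder M u) v          ≡⟨ ∗-comm Qh (leftBorder M u) v ⟩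
    (leftBorder M u ∗ Qh) v          ≡⟨ border≡leftBorder∗Qh M u v ⟨
    border M u v                     ∎
    where open ≡-Reasoning

  good-ᵀ : ∀ {G} → Good G → T.Good (λ M → G (M ᵀ))
  good-ᵀ {G} G-good c v u = trans (border-ᵀ (value c ᵀ) u v)
    (bordered-cong (value-reverse {G} c) (G-good (reverse c)) u v)

module RightDilation (n : ℕ) .{{_ : NonZero n}} (Ph Qh : Fin n → ℕ) where

  open GroupSemiring n
  open Matrices n
  open Bordering n Ph Qh
  private
    module T = Bordering n Qh Ph
    module PQ = Transposition n Ph Qh
    module QP = Transposition n Qh Ph

  -- Transposition swaps P and Q and turns right dilations into left ones.
  good-∪-rightDil : mass Ph * mass Qh ≡ n → ∀ D .{{_ : NonZero D}} → Coprime D (mass Ph) →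
                    ∀ {G X} → Good G → G X → Good (G ∪≈ rightDil D X)
  good-∪-rightDil hPQ D coprime {G} {X} G-good gX =
    good-mono back (QP.good-ᵀ (T.good-∪-leftDil (trans (*-comm (mass Qh) (mass Ph)) hPQ) D coprime (PQ.good-ᵀ G-good) gX))
    where
    back : ∀ {M} → (G ∪≈ rightDil D X) M → ((λ M → G (M ᵀ)) T.∪≈ leftDil D (X ᵀ)) (M ᵀ)
    back (inj₁ g)    = inj₁ g
    back (inj₂ M≈X′) = inj₂ (λ i j → M≈X′ j i)

module IntegerResidues (n : ℕ) .{{_ : NonZero n}} where

  open import Data.Integer using (+_; -[1+_]; _%ℕ_; _/ℕ_)
  open ℤ-Solver.+-*-Solver using (solve; _:+_; _:*_; _:-_; :-_; _:=_; con)

  open Mod n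

  private
    n≤r+[1+t]n : ∀ r t → n ≤ r + suc t * n
    n≤r+[1+t]n r t = ≤-trans (m≤m+n n (t * n)) (m≤n+m (suc t * n) r)

    no-positive-shift : ∀ {r s} t → r < n → + r ≡ + s ℤ.+ + suc t ℤ.* + n → ⊥
    no-positive-shift {r} {s} t r<n eq = <⇒≱ r<n (subst (n ≤_) (sym (ℤₚ.+-injective r≡)) (n≤r+[1+t]n s t))
      where
      r≡ : + r ≡ + (s + suc t * n)
      r≡ = trans eq (trans (cong (λ x → + s ℤ.+ x) (sym (ℤₚ.pos-* (suc t) n))) (sym (ℤₚ.pos-+ s (suc t * n))))

  remainders-equal : ∀ {r s} k → r < n → s < n → + r ≡ + s ℤ.+ k ℤ.* + n → r ≡ s
  remainders-equal {r} {s} (+ zero)  _   _   eq = ℤₚ.+-injective (trans eq (ℤₚ.+-identityʳ (+ s)))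
  remainders-equal {r} {s} (+ suc t) r<n _   eq = ⊥-elim (no-positive-shift t r<n eq)
  remainders-equal {r} {s} -[1+ t ]  _   s<n eq =
    ⊥-elim (no-positive-shift t s<n (trans (cancel (+ s) -[1+ t ] (+ n)) (cong (ℤ._+ + suc t ℤ.* + n) (sym eq))))
    where
    cancel : ∀ a k m → a ≡ a ℤ.+ k ℤ.* m ℤ.+ ℤ.- k ℤ.* m
    cancel = solve 3 (λ a k m → a := a :+ k :* m :+ :- k :* m) refl

  %ℕ-cong : ∀ a b k → a ≡ b ℤ.+ k ℤ.* + n → a %ℕ n ≡ b %ℕ n
  %ℕ-cong a b k eq = remainders-equal (b /ℕ n ℤ.+ k ℤ.- a /ℕ n) (n%ℕd<d a n) (n%ℕd<d b n) (begin
    + (a %ℕ n)                                                    ≡⟨ cancel (+ (a %ℕ n)) (a /ℕ n ℤ.* + n) ⟩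
    + (a %ℕ n) ℤ.+ a /ℕ n ℤ.* + n ℤ.- a /ℕ n ℤ.* + n                ≡⟨ cong (ℤ._- a /ℕ n ℤ.* + n) (sym (a≡a%ℕn+[a/ℕn]*n a n)) ⟩
    a ℤ.- a /ℕ n ℤ.* + n                                          ≡⟨ cong (ℤ._- a /ℕ n ℤ.* + n) (trans eq (cong (ℤ._+ k ℤ.* + n) (a≡a%ℕn+[a/ℕn]*n b n))) ⟩
    + (b %ℕ n) ℤ.+ b /ℕ n ℤ.* + n ℤ.+ k ℤ.* + n ℤ.- a /ℕ n ℤ.* + n  ≡⟨ regroup (+ (b %ℕ n)) (b /ℕ n) k (a /ℕ n) (+ n) ⟩
    + (b %ℕ n) ℤ.+ (b /ℕ n ℤ.+ k ℤ.- a /ℕ n) ℤ.* + n               ∎)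
    where
    open ≡-Reasoning
    cancel : ∀ x y → x ≡ x ℤ.+ y ℤ.- y
    cancel = solve 2 (λ x y → x := x :+ y :- y) refl
    regroup : ∀ r x k y m → r ℤ.+ x ℤ.* m ℤ.+ k ℤ.* m ℤ.- y ℤ.* m ≡ r ℤ.+ (x ℤ.+ k ℤ.- y) ℤ.* m
    regroup = solve 5 (λ r x k y m → r :+ x :* m :+ k :* m :- y :* m := r :+ (x :+ k :- y) :* m) refl

  %ℕ-+ˡ : ∀ p x → (p ℤ.+ + x) %ℕ n ≡ (p %ℕ n + x) % n
  %ℕ-+ˡ p x = %ℕ-cong (p ℤ.+ + x) (+ (p %ℕ n + x)) (p /ℕ n) (begin
    p ℤ.+ + x                                  ≡⟨ cong (ℤ._+ + x) (a≡a%ℕn+[a/ℕn]*n p n) ⟩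
    + (p %ℕ n) ℤ.+ p /ℕ n ℤ.* + n ℤ.+ + x      ≡⟨ swap (+ (p %ℕ n)) (p /ℕ n ℤ.* + n) (+ x) ⟩
    + (p %ℕ n) ℤ.+ + x ℤ.+ p /ℕ n ℤ.* + n      ≡⟨ cong (ℤ._+ p /ℕ n ℤ.* + n) (sym (ℤₚ.pos-+ (p %ℕ n) x)) ⟩
    + (p %ℕ n + x) ℤ.+ p /ℕ n ℤ.* + n          ∎)
    where
    open ≡-Reasoning
    swap : ∀ a b c → a ℤ.+ b ℤ.+ c ≡ a ℤ.+ c ℤ.+ b
    swap = solve 3 (λ a b c → a :+ b :+ c := a :+ c :+ b) refl

  [_]ℤ : ℤ → Fin n
  [ z ]ℤ = [ z %ℕ n ]

  toℕ-[]ℤ⊕ : ∀ p x → toℕ ([ p ]ℤ ⊕ x) ≡ (p ℤ.+ + toℕ x) %ℕ n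
  toℕ-[]ℤ⊕ p x = begin
    toℕ ([ p ]ℤ ⊕ x)               ≡⟨ cong (λ y → toℕ ([ p ]ℤ ⊕ y)) ([]-toℕ x) ⟨
    toℕ ([ p ]ℤ ⊕ [ toℕ x ])       ≡⟨ cong toℕ ([]-+ (p %ℕ n) (toℕ x)) ⟨
    toℕ [ p %ℕ n + toℕ x ]         ≡⟨ toℕ-[] (p %ℕ n + toℕ x) ⟩
    (p %ℕ n + toℕ x) % n           ≡⟨ %ℕ-+ˡ p (toℕ x) ⟨
    (p ℤ.+ + toℕ x) %ℕ n           ∎
    where open ≡-Reasoning

  toℕ-⊕[]ℤ : ∀ y q → toℕ (y ⊕ [ q ]ℤ) ≡ (+ toℕ y ℤ.+ q) %ℕ n
  toℕ-⊕[]ℤ y q = trans (cong toℕ (⊕-comm y [ q ]ℤ)) (trans (toℕ-[]ℤ⊕ q y) (cong (_%ℕ n) (ℤₚ.+-comm q (+ toℕ y))))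

  record Representative (d : ℤ) (m : ℕ) : Set where
    field
      D         : ℕ
      D-nonZero : NonZero D
      coprime   : Coprime D m
      toℕ-D⊙    : ∀ i → toℕ (D ⊙ i) ≡ (d ℤ.* + toℕ i) %ℕ n

  representative : ∀ d {m} → m ∣ n → Coprime ∣ d ∣ m → Representative d m
  representative d {m} m∣n coprime-d = record
    { D         = D
    ; D-nonZero = >-nonZero (<-≤-trans (>-nonZero⁻¹ n) (m≤m+n n (d %ℕ n)))
    ; coprime   = coprime-D
    ; toℕ-D⊙    = λ i → trans (toℕ-[] (D * toℕ i)) (sym (%ℕ-cong (d ℤ.* + toℕ i) (+ (D * toℕ i)) (K ℤ.* + toℕ i) (d*i≡ (toℕ i))))
    }
    where
    open ≡-Reasoning
    -- n is added so that D ≢ 0 and can be factored into primes.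
    D : ℕ
    D = n + d %ℕ n
    K : ℤ
    K = d /ℕ n ℤ.- + 1
    d≡ : d ≡ + D ℤ.+ K ℤ.* + n
    d≡ = begin
      d                                      ≡⟨ a≡a%ℕn+[a/ℕn]*n d n ⟩
      + (d %ℕ n) ℤ.+ d /ℕ n ℤ.* + n          ≡⟨ shift (+ (d %ℕ n)) (d /ℕ n) (+ n) ⟩
      + n ℤ.+ + (d %ℕ n) ℤ.+ K ℤ.* + n       ≡⟨ cong (ℤ._+ K ℤ.* + n) (sym (ℤₚ.pos-+ n (d %ℕ n))) ⟩
      + D ℤ.+ K ℤ.* + n                      ∎
      where
      shift : ∀ r q m → r ℤ.+ q ℤ.* m ≡ m ℤ.+ r ℤ.+ (q ℤ.- + 1) ℤ.* m
      shift = solve 3 (λ r q m → r :+ q :* m := m :+ r :+ (q :- con (+ 1)) :* m) refl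
    d*i≡ : ∀ i → d ℤ.* + i ≡ + (D * i) ℤ.+ K ℤ.* + i ℤ.* + n
    d*i≡ i = begin
      d ℤ.* + i                              ≡⟨ cong (ℤ._* + i) d≡ ⟩
      (+ D ℤ.+ K ℤ.* + n) ℤ.* + i            ≡⟨ distrib (+ D) K (+ n) (+ i) ⟩
      + D ℤ.* + i ℤ.+ K ℤ.* + i ℤ.* + n      ≡⟨ cong (ℤ._+ K ℤ.* + i ℤ.* + n) (sym (ℤₚ.pos-* D i)) ⟩
      + (D * i) ℤ.+ K ℤ.* + i ℤ.* + n        ∎
      where
      distrib : ∀ a k m b → (a ℤ.+ k ℤ.* m) ℤ.* b ≡ a ℤ.* b ℤ.+ k ℤ.* b ℤ.* m
      distrib = solve 4 (λ a k m b → (a :+ k :* m) :* b := a :* b :+ k :* b :* m) refl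
    coprime-D : Coprime D m
    coprime-D {c} (c∣D , c∣m) = coprime-d (c∣∣d∣ , c∣m)
      where
      c∣n : c ∣ n
      c∣n = ∣-trans c∣m m∣n
      c∣d%n : c ∣ d %ℕ n
      c∣d%n = ∣m+n∣m⇒∣n c∣D c∣n
      c∣∣d∣ : c ∣ ∣ d ∣
      c∣∣d∣ = ℤ∣.∣⇒∣ᵤ (subst (ℤ∣._∣_ (+ c)) (sym (a≡a%ℕn+[a/ℕn]*n d n))
                (ℤ∣.∣m∣n⇒∣m+n {m = + (d %ℕ n)} (ℤ∣.∣ᵤ⇒∣ c∣d%n) (ℤ∣.∣n⇒∣m*n (d /ℕ n) {+ n} (ℤ∣.∣ᵤ⇒∣ c∣n))))

module Indicators (n : ℕ) .{{_ : NonZero n}} where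

  open import Data.Integer using (+_; _%ℕ_)

  open Mod n
  open GroupSemiring n
  open Matrices n

  ⟦_⟧ : Sub n → Mat
  ⟦ X ⟧ i j = 𝟙 (X i j)

  card≡total : ∀ X → card X ≡ total ⟦ X ⟧
  card≡total X = trans (sum-allFin (λ i → List.sum (map (⟦ X ⟧ i) (allFin n)))) (sum-cong-≗ λ i → sum-allFin (⟦ X ⟧ i))

  𝟙⌊≟⌋≡δ : ∀ {a} {c d : Fin n} → toℕ c ≡ a → 𝟙 ⌊ a ℕ.≟ toℕ d ⌋ ≡ δ c d
  𝟙⌊≟⌋≡δ {a} {c} {d} toℕc≡a = 𝟙⌊⌋-⇔ (a ℕ.≟ toℕ d) (c ≟ d)
    (λ a≡d → Finₚ.toℕ-injective (trans toℕc≡a a≡d)) (λ c≡d → trans (sym toℕc≡a) (cong toℕ c≡d))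

  compose-term : ∀ A B (r i l j k : Fin n) →
    𝟙 (A i j ∧ B k l ∧ ⌊ (toℕ j + toℕ k) % n ℕ.≟ toℕ r ⌋) ≡ ⟦ A ⟧ i j * ⟦ B ⟧ k l * δ (j ⊕ k) r
  compose-term A B r i l j k = begin
    𝟙 (A i j ∧ B k l ∧ ⌊ r? ⌋)               ≡⟨ 𝟙-∧ (A i j) _ ⟩
    ⟦ A ⟧ i j * 𝟙 (B k l ∧ ⌊ r? ⌋)           ≡⟨ cong (⟦ A ⟧ i j *_) (𝟙-∧ (B k l) _) ⟩
    ⟦ A ⟧ i j * (⟦ B ⟧ k l * 𝟙 ⌊ r? ⌋)       ≡⟨ cong (λ x → ⟦ A ⟧ i j * (⟦ B ⟧ k l * x)) (𝟙⌊≟⌋≡δ (toℕ-[] (toℕ j + toℕ k))) ⟩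
    ⟦ A ⟧ i j * (⟦ B ⟧ k l * δ (j ⊕ k) r)    ≡⟨ *-assoc (⟦ A ⟧ i j) _ _ ⟨
    ⟦ A ⟧ i j * ⟦ B ⟧ k l * δ (j ⊕ k) r      ∎
    where
    open ≡-Reasoning
    r? : Dec ((toℕ j + toℕ k) % n ≡ toℕ r)
    r? = (toℕ j + toℕ k) % n ℕ.≟ toℕ r

  ⟦compose⟧≤∘ : ∀ A r B i l → ⟦ compose n A r B ⟧ i l ≤ (⟦ A ⟧ ∘⟨ r ⟩ ⟦ B ⟧) i l
  ⟦compose⟧≤∘ A r B i l = subst (⟦ compose n A r B ⟧ i l ≤_) (sum-cong-≗ λ j → sum-cong-≗ λ k → compose-term A B r i l j k)
    (𝟙-any²≤∑∑ (λ j k → A i j ∧ B k l ∧ ⌊ (toℕ j + toℕ k) % n ℕ.≟ toℕ r ⌋))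

  ∘≈⟦compose⟧ : ∀ A r B → (∀ i l → (⟦ A ⟧ ∘⟨ r ⟩ ⟦ B ⟧) i l ≤ 1) → ⟦ A ⟧ ∘⟨ r ⟩ ⟦ B ⟧ ≈ ⟦ compose n A r B ⟧
  ∘≈⟦compose⟧ A r B ∘≤1 i l = sym (trans (𝟙-any²≡∑∑ F (subst (_≤ 1) (sym terms) (∘≤1 i l))) terms)
    where
    F : Fin n → Fin n → Bool
    F j k = A i j ∧ B k l ∧ ⌊ (toℕ j + toℕ k) % n ℕ.≟ toℕ r ⌋
    terms : ∑[ j < n ] ∑[ k < n ] 𝟙 (F j k) ≡ (⟦ A ⟧ ∘⟨ r ⟩ ⟦ B ⟧) i l
    terms = sum-cong-≗ λ j → sum-cong-≗ λ k → compose-term A B r i l j k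

  module _ {d₁ d₂ : ℤ} {D₁ D₂ : ℕ}
           (toℕ-D₁⊙ : ∀ i → toℕ (D₁ ⊙ i) ≡ (d₁ ℤ.* + toℕ i) %ℕ n)
           (toℕ-D₂⊙ : ∀ j → toℕ (D₂ ⊙ j) ≡ (d₂ ℤ.* + toℕ j) %ℕ n) where

    phi-term : ∀ X (i′ j′ i j : Fin n) →
      𝟙 (X i j ∧ ⌊ (d₁ ℤ.* + toℕ i) %ℕ n ℕ.≟ toℕ i′ ⌋ ∧ ⌊ (d₂ ℤ.* + toℕ j) %ℕ n ℕ.≟ toℕ j′ ⌋)
        ≡ ⟦ X ⟧ i j * δ (D₁ ⊙ i) i′ * δ (D₂ ⊙ j) j′
    phi-term X i′ j′ i j = begin
      𝟙 (X i j ∧ ⌊ i? ⌋ ∧ ⌊ j? ⌋)                        ≡⟨ 𝟙-∧ (X i j) _ ⟩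
      ⟦ X ⟧ i j * 𝟙 (⌊ i? ⌋ ∧ ⌊ j? ⌋)                    ≡⟨ cong (⟦ X ⟧ i j *_) (𝟙-∧ ⌊ i? ⌋ ⌊ j? ⌋) ⟩
      ⟦ X ⟧ i j * (𝟙 ⌊ i? ⌋ * 𝟙 ⌊ j? ⌋)                  ≡⟨ cong₂ (λ a b → ⟦ X ⟧ i j * (a * b)) (𝟙⌊≟⌋≡δ (toℕ-D₁⊙ i)) (𝟙⌊≟⌋≡δ (toℕ-D₂⊙ j)) ⟩
      ⟦ X ⟧ i j * (δ (D₁ ⊙ i) i′ * δ (D₂ ⊙ j) j′)        ≡⟨ *-assoc (⟦ X ⟧ i j) _ _ ⟨
      ⟦ X ⟧ i j * δ (D₁ ⊙ i) i′ * δ (D₂ ⊙ j) j′          ∎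
      where
      open ≡-Reasoning
      i? : Dec ((d₁ ℤ.* + toℕ i) %ℕ n ≡ toℕ i′)
      i? = (d₁ ℤ.* + toℕ i) %ℕ n ℕ.≟ toℕ i′
      j? : Dec ((d₂ ℤ.* + toℕ j) %ℕ n ≡ toℕ j′)
      j? = (d₂ ℤ.* + toℕ j) %ℕ n ℕ.≟ toℕ j′

    dil²≈⟦phi⟧ : ∀ X → (∀ i j → rightDil D₂ (leftDil D₁ ⟦ X ⟧) i j ≤ 1) → rightDil D₂ (leftDil D₁ ⟦ X ⟧) ≈ ⟦ phi n d₁ d₂ X ⟧
    dil²≈⟦phi⟧ X dil²≤1 i′ j′ = sym (trans (𝟙-any²≡∑∑ F (subst (_≤ 1) (sym terms) (dil²≤1 i′ j′))) terms)
      where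
      F : Fin n → Fin n → Bool
      F i j = X i j ∧ ⌊ (d₁ ℤ.* + toℕ i) %ℕ n ℕ.≟ toℕ i′ ⌋ ∧ ⌊ (d₂ ℤ.* + toℕ j) %ℕ n ℕ.≟ toℕ j′ ⌋
      terms : ∑[ i < n ] ∑[ j < n ] 𝟙 (F i j) ≡ rightDil D₂ (leftDil D₁ ⟦ X ⟧) i′ j′
      terms = begin
        ∑[ i < n ] ∑[ j < n ] 𝟙 (F i j)                                  ≡⟨ sum-cong-≗ (λ i → sum-cong-≗ λ j → phi-term X i′ j′ i j) ⟩
        ∑[ i < n ] ∑[ j < n ] (⟦ X ⟧ i j * δ (D₁ ⊙ i) i′ * δ (D₂ ⊙ j) j′)  ≡⟨ ∑-comm (λ i j → ⟦ X ⟧ i j * δ (D₁ ⊙ i) i′ * δ (D₂ ⊙ j) j′) ⟩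
        ∑[ j < n ] ∑[ i < n ] (⟦ X ⟧ i j * δ (D₁ ⊙ i) i′ * δ (D₂ ⊙ j) j′)  ≡⟨ sum-cong-≗ (λ j → *-distribʳ-sum (δ (D₂ ⊙ j) j′) (λ i → ⟦ X ⟧ i j * δ (D₁ ⊙ i) i′)) ⟨
        rightDil D₂ (leftDil D₁ ⟦ X ⟧) i′ j′                              ∎
        where open ≡-Reasoning

module Histograms (n : ℕ) .{{_ : NonZero n}} where

  open Mod n
  open GroupSemiring n
  open IntegerResidues n

  hist : List ℤ → Fn
  hist L a = ∑[ t < length L ] δ [ lookup L t ]ℤ a

  mass-hist : ∀ L → mass (hist L) ≡ length L
  mass-hist L = begin
    ∑[ a < n ] ∑[ t < length L ] δ [ lookup L t ]ℤ a   ≡⟨ ∑-comm (λ a t → δ [ lookup L t ]ℤ a) ⟩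
    ∑[ t < length L ] ∑[ a < n ] δ [ lookup L t ]ℤ a   ≡⟨ sum-cong-≗ (λ t → ∑-δ [ lookup L t ]ℤ) ⟩
    ∑[ t < length L ] 1                                ≡⟨ ∑-const (length L) 1 ⟩
    length L * 1                                       ≡⟨ *-identityʳ (length L) ⟩
    length L                                           ∎
    where open ≡-Reasoning

  hist-∗ : ∀ L g i → (hist L ∗ g) i ≡ ∑[ t < length L ] ∑[ x < n ] (g x * δ ([ lookup L t ]ℤ ⊕ x) i)
  hist-∗ L g i = begin
    ∑[ a < n ] ∑[ x < n ] (hist L a * g x * δ (a ⊕ x) i)
      ≡⟨ sum-cong-≗ (λ a → sum-cong-≗ λ x → ∑-*-* (λ t → δ (ĉ t) a) (g x) (δ (a ⊕ x) i)) ⟩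
    ∑[ a < n ] ∑[ x < n ] ∑[ t < length L ] (δ (ĉ t) a * g x * δ (a ⊕ x) i)
      ≡⟨ sum-cong-≗ (λ a → ∑-comm (λ x t → δ (ĉ t) a * g x * δ (a ⊕ x) i)) ⟩
    ∑[ a < n ] ∑[ t < length L ] ∑[ x < n ] (δ (ĉ t) a * g x * δ (a ⊕ x) i)
      ≡⟨ ∑-comm (λ a t → ∑[ x < n ] (δ (ĉ t) a * g x * δ (a ⊕ x) i)) ⟩
    ∑[ t < length L ] ∑[ a < n ] ∑[ x < n ] (δ (ĉ t) a * g x * δ (a ⊕ x) i)
      ≡⟨ sum-cong-≗ (λ t → trans (sum-cong-≗ λ a → sum-cong-≗ λ x → *-assoc (δ (ĉ t) a) (g x) _)
                                 (∑∑-δˡ (ĉ t) (λ a x → g x * δ (a ⊕ x) i))) ⟩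
    ∑[ t < length L ] ∑[ x < n ] (g x * δ (ĉ t ⊕ x) i)
      ∎
    where
    open ≡-Reasoning
    ĉ : Fin (length L) → Fin n
    ĉ t = [ lookup L t ]ℤ

  ∗-hist : ∀ L g j → (g ∗ hist L) j ≡ ∑[ s < length L ] ∑[ y < n ] (g y * δ (y ⊕ [ lookup L s ]ℤ) j)
  ∗-hist L g j = trans (∗-comm g (hist L) j) (trans (hist-∗ L g j)
    (sum-cong-≗ λ s → sum-cong-≗ λ y → cong (λ z → g y * δ z j) (⊕-comm [ lookup L s ]ℤ y)))

module Coefficients (n : ℕ) .{{_ : NonZero n}} (P Q : List ℤ) where

  open import Data.Integer using (+_; _%ℕ_)
  open +-*-Solver using (solve; _:*_; _:=_)

  open Mod n
  open GroupSemiring n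
  open Matrices n
  open IntegerResidues n
  open Indicators n
  open Histograms n
  open Bordering n (hist P) (hist Q)

  coeff-term : ∀ X (i j : Fin n) p q x y →
    𝟙 (X x y ∧ ⌊ (p ℤ.+ + toℕ x) %ℕ n ℕ.≟ toℕ i ⌋ ∧ ⌊ (+ toℕ y ℤ.+ q) %ℕ n ℕ.≟ toℕ j ⌋)
      ≡ ⟦ X ⟧ x y * δ ([ p ]ℤ ⊕ x) i * δ (y ⊕ [ q ]ℤ) j
  coeff-term X i j p q x y = begin
    𝟙 (X x y ∧ ⌊ i? ⌋ ∧ ⌊ j? ⌋)                              ≡⟨ 𝟙-∧ (X x y) _ ⟩
    ⟦ X ⟧ x y * 𝟙 (⌊ i? ⌋ ∧ ⌊ j? ⌋)                          ≡⟨ cong (⟦ X ⟧ x y *_) (𝟙-∧ ⌊ i? ⌋ ⌊ j? ⌋) ⟩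
    ⟦ X ⟧ x y * (𝟙 ⌊ i? ⌋ * 𝟙 ⌊ j? ⌋)                        ≡⟨ cong₂ (λ a b → ⟦ X ⟧ x y * (a * b)) (𝟙⌊≟⌋≡δ (toℕ-[]ℤ⊕ p x)) (𝟙⌊≟⌋≡δ (toℕ-⊕[]ℤ y q)) ⟩
    ⟦ X ⟧ x y * (δ ([ p ]ℤ ⊕ x) i * δ (y ⊕ [ q ]ℤ) j)        ≡⟨ *-assoc (⟦ X ⟧ x y) _ _ ⟨
    ⟦ X ⟧ x y * δ ([ p ]ℤ ⊕ x) i * δ (y ⊕ [ q ]ℤ) j          ∎
    where
    open ≡-Reasoning
    i? : Dec ((p ℤ.+ + toℕ x) %ℕ n ≡ toℕ i)
    i? = (p ℤ.+ + toℕ x) %ℕ n ℕ.≟ toℕ i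
    j? : Dec ((+ toℕ y ℤ.+ q) %ℕ n ≡ toℕ j)
    j? = (+ toℕ y ℤ.+ q) %ℕ n ℕ.≟ toℕ j

  coeff≡border : ∀ X i j → coeff n P X Q i j ≡ border ⟦ X ⟧ i j
  coeff≡border X i j = begin
    coeff n P X Q i j
      ≡⟨ trans (sum-map≡∑-lookup (λ p → List.sum (map (∑ˣʸterm p) Q)) P) (sum-cong-≗ λ t →
           trans (sum-map≡∑-lookup (∑ˣʸterm (p̂ t)) Q) (sum-cong-≗ λ s →
           trans (sum-allFin (∑ʸterm (p̂ t) (q̂ s))) (sum-cong-≗ λ x →
           trans (sum-allFin (term (p̂ t) (q̂ s) x)) (sum-cong-≗ λ y → coeff-term X i j (p̂ t) (q̂ s) x y)))) ⟩
    ∑[ t < length P ] ∑[ s < length Q ] ∑[ x < n ] ∑[ y < n ] (⟦ X ⟧ x y * δ ([ p̂ t ]ℤ ⊕ x) i * δ (y ⊕ [ q̂ s ]ℤ) j)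
      ≡⟨ sum-cong-≗ (λ t → ∑-comm (λ x s → ∑[ y < n ] (⟦ X ⟧ x y * δ ([ p̂ t ]ℤ ⊕ x) i * δ (y ⊕ [ q̂ s ]ℤ) j))) ⟨
    ∑[ t < length P ] ∑[ x < n ] ∑[ s < length Q ] ∑[ y < n ] (⟦ X ⟧ x y * δ ([ p̂ t ]ℤ ⊕ x) i * δ (y ⊕ [ q̂ s ]ℤ) j)
      ≡⟨ sum-cong-≗ (λ t → sum-cong-≗ λ x → trans (sum-cong-≗ λ s → sum-cong-≗ λ y → swap (⟦ X ⟧ x y) (δ ([ p̂ t ]ℤ ⊕ x) i) (δ (y ⊕ [ q̂ s ]ℤ) j))
                                                  (sym (∑∑-* (λ s y → ⟦ X ⟧ x y * δ (y ⊕ [ q̂ s ]ℤ) j) (δ ([ p̂ t ]ℤ ⊕ x) i)))) ⟩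
    ∑[ t < length P ] ∑[ x < n ] (∑[ s < length Q ] ∑[ y < n ] (⟦ X ⟧ x y * δ (y ⊕ [ q̂ s ]ℤ) j) * δ ([ p̂ t ]ℤ ⊕ x) i)
      ≡⟨ sum-cong-≗ (λ t → sum-cong-≗ λ x → cong (_* δ ([ p̂ t ]ℤ ⊕ x) i) (∗-hist Q (⟦ X ⟧ x) j)) ⟨
    ∑[ t < length P ] ∑[ x < n ] ((⟦ X ⟧ x ∗ hist Q) j * δ ([ p̂ t ]ℤ ⊕ x) i)
      ≡⟨ hist-∗ P (λ x → (⟦ X ⟧ x ∗ hist Q) j) i ⟨
    border ⟦ X ⟧ i j
      ∎
    where
    open ≡-Reasoning
    p̂ : Fin (length P) → ℤ
    p̂ = lookup P
    q̂ : Fin (length Q) → ℤ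
    q̂ = lookup Q
    term : ℤ → ℤ → Fin n → Fin n → ℕ
    term p q x y = 𝟙 (X x y ∧ ⌊ (p ℤ.+ + toℕ x) %ℕ n ℕ.≟ toℕ i ⌋ ∧ ⌊ (+ toℕ y ℤ.+ q) %ℕ n ℕ.≟ toℕ j ⌋)
    ∑ʸterm : ℤ → ℤ → Fin n → ℕ
    ∑ʸterm p q x = List.sum (map (term p q x) (allFin n))
    ∑ˣʸterm : ℤ → ℤ → ℕ
    ∑ˣʸterm p q = List.sum (map (∑ʸterm p q) (allFin n))
    swap : ∀ a b c → a * b * c ≡ a * c * b
    swap = solve 3 (λ a b c → a :* b :* c := a :* c :* b) refl

compositions⊆stable : ∀ {n} .{{_ : NonZero n}} {F Z} → Compositions n F Z → StableOf n F Z
compositions⊆stable (single X∈F)   = base X∈F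
compositions⊆stable (step c r Y∈F) = comp (compositions⊆stable c) r (base Y∈F)

module Families (n : ℕ) .{{_ : NonZero n}} (P Q : List ℤ) where

  open Mod n using (_⊕_)
  open GroupSemiring n
  open Matrices n
  open Indicators n
  open Histograms n
  open Coefficients n P Q
  open Bordering n (hist P) (hist Q)

  Realised : Family n → Mat → Set
  Realised E M = ∃ λ X → E X × M ≈ ⟦ X ⟧

  borders⇒bordered : ∀ {X} → Borders n P Q X → Bordered ⟦ X ⟧
  borders⇒bordered {X} X-borders u v = trans (sym (coeff≡border X u v)) (X-borders u v)

  bordered⇒borders : ∀ {X} → Bordered ⟦ X ⟧ → Borders n P Q X
  bordered⇒borders {X} X-bordered u v = trans (coeff≡border X u v) (X-bordered u v)

  borders⇒|P|*|Q|≡n : ∀ {X} → Borders n P Q X → card X ≡ n → length P * length Q ≡ n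
  borders⇒|P|*|Q|≡n {X} X-borders card≡n = trans (cong₂ _*_ (sym (mass-hist P)) (sym (mass-hist Q)))
    (bordered⇒mass-product (borders⇒bordered {X} X-borders) (trans (sym (card≡total X)) card≡n))

  module FromStable (E : Family n) (E°-borders : BordersFamily n P Q (StableOf n E))
                    (hPQ : mass (hist P) * mass (hist Q) ≡ n) where

    total-stable : ∀ {Z} → StableOf n E Z → total ⟦ Z ⟧ ≡ n
    total-stable {Z} Z∈E° = bordered⇒total≡n hPQ (borders⇒bordered {Z} (E°-borders Z Z∈E°))

    -- The ℕ-composition dominates the set composition and both have total n · n over all r.
    ∘≈⟦compose⟧-stable : ∀ {X Z} → E X → StableOf n E Z → ∀ r → ⟦ X ⟧ ∘⟨ r ⟩ ⟦ Z ⟧ ≈ ⟦ compose n X r Z ⟧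
    ∘≈⟦compose⟧-stable {X} {Z} X∈E Z∈E° r = ≈-sym (total-≥⇒≈ (⟦compose⟧≤∘ X r Z) (≤-reflexive (totals-equal r)))
      where
      open ≡-Reasoning
      ∑-totals-equal : ∑[ r < n ] total (⟦ X ⟧ ∘⟨ r ⟩ ⟦ Z ⟧) ≡ ∑[ r < n ] total ⟦ compose n X r Z ⟧
      ∑-totals-equal = begin
        ∑[ r < n ] total (⟦ X ⟧ ∘⟨ r ⟩ ⟦ Z ⟧)   ≡⟨ ∑-total-∘ ⟦ X ⟧ ⟦ Z ⟧ ⟩
        total ⟦ X ⟧ * total ⟦ Z ⟧             ≡⟨ cong₂ _*_ (total-stable (base X∈E)) (total-stable Z∈E°) ⟩
        n * n                                 ≡⟨ ∑-const n n ⟨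
        ∑[ r < n ] n                          ≡⟨ sum-cong-≗ (λ r → total-stable (comp (base X∈E) r Z∈E°)) ⟨
        ∑[ r < n ] total ⟦ compose n X r Z ⟧   ∎
      totals-equal : ∀ r → total (⟦ X ⟧ ∘⟨ r ⟩ ⟦ Z ⟧) ≡ total ⟦ compose n X r Z ⟧
      totals-equal r = sym (∑-≥⇒≗ (λ r → total-mono (⟦compose⟧≤∘ X r Z)) (≤-reflexive ∑-totals-equal) r)

    chain-stable : ∀ (c : Chain (Realised E)) → ∃ λ Z → StableOf n E Z × value c ≈ ⟦ Z ⟧
    chain-stable [ X , X∈E , M≈X ] = X , base X∈E , M≈X
    chain-stable ((X , X∈E , M≈X) ∷⟨ r ⟩ c) with chain-stable c
    ... | Z , Z∈E° , c≈Z = compose n X r Z , comp (base X∈E) r Z∈E° ,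
                           ≈-trans (∘-cong r M≈X c≈Z) (∘≈⟦compose⟧-stable X∈E Z∈E° r)

    good-realised : Good (Realised E)
    good-realised c with chain-stable c
    ... | Z , Z∈E° , c≈Z = bordered-cong (≈-sym c≈Z) (borders⇒bordered {Z} (E°-borders Z Z∈E°))

  module FromGood (F : Family n) (F-good : Good (Realised F))
                  (mass-P≥1 : 1 ≤ mass (hist P)) (mass-Q≥1 : 1 ≤ mass (hist Q)) where

    ChainValue : Sub n → Set
    ChainValue Z = ∃ λ (c : Chain (Realised F)) → value c ≈ ⟦ Z ⟧

    ∘≤1 : ∀ {U Z} → ChainValue U → ChainValue Z → ∀ r i l → (⟦ U ⟧ ∘⟨ r ⟩ ⟦ Z ⟧) i l ≤ 1
    ∘≤1 {U} {Z} (c , c≈U) (d , d≈Z) r = bordered⇒≤1 mass-P≥1 mass-Q≥1 {⟦ U ⟧ ∘⟨ r ⟩ ⟦ Z ⟧}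
      (bordered-cong (≈-trans (value-++ c r d) (∘-cong r c≈U d≈Z)) (F-good (c ++⟨ r ⟩ d)))

    stable-chainValue : ∀ {Z} → StableOf n F Z → ChainValue Z
    stable-chainValue (base {X} X∈F) = [ X , X∈F , ≈-refl ] , ≈-refl
    stable-chainValue (comp {U} {Z} U∈F° r Z∈F°) with stable-chainValue U∈F° | stable-chainValue Z∈F°
    ... | cU@(c , c≈U) | cZ@(d , d≈Z) = c ++⟨ r ⟩ d ,
      ≈-trans (value-++ c r d) (≈-trans (∘-cong r c≈U d≈Z) (∘≈⟦compose⟧ U r Z (∘≤1 cU cZ r)))

    stable-bordered : ∀ {Z} → StableOf n F Z → Bordered ⟦ Z ⟧
    stable-bordered Z∈F° with stable-chainValue Z∈F°
    ... | c , c≈Z = bordered-cong c≈Z (F-good c)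

    ∘-stable≤1 : ∀ {U Z} → StableOf n F U → StableOf n F Z → ∀ r i l → (⟦ U ⟧ ∘⟨ r ⟩ ⟦ Z ⟧) i l ≤ 1
    ∘-stable≤1 U∈F° Z∈F° = ∘≤1 (stable-chainValue U∈F°) (stable-chainValue Z∈F°)

    unambiguous : ∀ {U Z} → StableOf n F U → StableOf n F Z → ∀ {i j j′ k k′ l} → j ≢ j′ →
                  U i j ≡ true → U i j′ ≡ true → Z k l ≡ true → Z k′ l ≡ true → j ⊕ k ≡ j′ ⊕ k′ → ⊥
    unambiguous {U} {Z} U∈F° Z∈F° {i} {j} {j′} {k} {k′} {l} j≢j′ Uij Uij′ Zkl Zk′l r≡ =
      <⇒≱ (s≤s (s≤s z≤n)) (≤-trans (+-mono-≤ (contribution Uij Zkl refl) (contribution Uij′ Zk′l (sym r≡)))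
                          (≤-trans (two-terms≤∑ g j≢j′) (∘-stable≤1 U∈F° Z∈F° (j ⊕ k) i l)))
      where
      g : Fin n → ℕ
      g x = ∑[ y < n ] (⟦ U ⟧ i x * ⟦ Z ⟧ y l * δ (x ⊕ y) (j ⊕ k))
      contribution : ∀ {x y} → U i x ≡ true → Z y l ≡ true → x ⊕ y ≡ j ⊕ k → 1 ≤ g x
      contribution {x} {y} Uix Zyl x⊕y≡r = ≤-trans (≤-reflexive (sym one)) (term≤∑ (λ y → ⟦ U ⟧ i x * ⟦ Z ⟧ y l * δ (x ⊕ y) (j ⊕ k)) y)
        where
        one : ⟦ U ⟧ i x * ⟦ Z ⟧ y l * δ (x ⊕ y) (j ⊕ k) ≡ 1
        one = trans (cong₂ (λ u z → 𝟙 u * 𝟙 z * δ (x ⊕ y) (j ⊕ k)) Uix Zyl)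
                    (trans (+-identityʳ _) (trans (cong (δ (x ⊕ y)) (sym x⊕y≡r)) (δ-refl (x ⊕ y))))

module Code {A : Set} (a b : A) (a≢b : a ≢ b) (n : ℕ) .{{_ : NonZero n}} where

  open +-*-Solver using (solve; _:+_; _:*_; _:=_; con)

  open Mod n

  data Token : Set where
    aⁿ : Token
    ab : Fin n → Fin n → Token

  word : Token → List A
  word aⁿ       = a ^w n
  word (ab i j) = (a ^w toℕ i) ++ b ∷ (a ^w toℕ j)

  Valid : Sub n → Token → Set
  Valid Z aⁿ       = ⊤
  Valid Z (ab i j) = Z i j ≡ true

  tokenize : ∀ {Z} xs → All (withAn a b Z) xs → ∃ λ ts → All (Valid Z) ts × xs ≡ map word ts
  tokenize []       []                                     = [] , [] , refl
  tokenize (_ ∷ xs) (inj₁ x≡aⁿ ∷ xs-valid)                 with tokenize xs xs-valid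
  ... | ts , ts-valid , xs≡ = aⁿ ∷ ts , tt ∷ ts-valid , cong₂ _∷_ x≡aⁿ xs≡
  tokenize (_ ∷ xs) (inj₂ (i , j , Zij , x≡) ∷ xs-valid) with tokenize xs xs-valid
  ... | ts , ts-valid , xs≡ = ab i j ∷ ts , Zij ∷ ts-valid , cong₂ _∷_ x≡ xs≡

  lead : List Token → ℕ
  lead []            = 0
  lead (aⁿ ∷ ts)     = n + lead ts
  lead (ab i j ∷ ts) = toℕ i

  later : List Token → List ℕ
  later []            = []
  later (aⁿ ∷ ts)     = later ts
  later (ab i j ∷ ts) = (toℕ j + lead ts) ∷ later ts

  spell : ℕ → List ℕ → List A
  spell (suc e) es       = a ∷ spell e es
  spell zero    []       = []
  spell zero    (f ∷ es) = b ∷ spell f es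

  a^++spell : ∀ m e es → (a ^w m) ++ spell e es ≡ spell (m + e) es
  a^++spell zero    e es = refl
  a^++spell (suc m) e es = cong (a ∷_) (a^++spell m e es)

  concat-words : ∀ ts → concat (map word ts) ≡ spell (lead ts) (later ts)
  concat-words []            = refl
  concat-words (aⁿ ∷ ts)     = trans (cong ((a ^w n) ++_) (concat-words ts)) (a^++spell n (lead ts) (later ts))
  concat-words (ab i j ∷ ts) = begin
    ((a ^w toℕ i) ++ b ∷ (a ^w toℕ j)) ++ concat (map word ts)   ≡⟨ ++-assoc (a ^w toℕ i) _ _ ⟩
    (a ^w toℕ i) ++ b ∷ ((a ^w toℕ j) ++ concat (map word ts))   ≡⟨ cong (λ w → (a ^w toℕ i) ++ b ∷ ((a ^w toℕ j) ++ w)) (concat-words ts) ⟩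
    (a ^w toℕ i) ++ b ∷ ((a ^w toℕ j) ++ spell (lead ts) (later ts)) ≡⟨ cong (λ w → (a ^w toℕ i) ++ b ∷ w) (a^++spell (toℕ j) (lead ts) (later ts)) ⟩
    (a ^w toℕ i) ++ spell 0 (later (ab i j ∷ ts))                ≡⟨ a^++spell (toℕ i) 0 _ ⟩
    spell (toℕ i + 0) (later (ab i j ∷ ts))                      ≡⟨ cong (λ e → spell e _) (+-identityʳ (toℕ i)) ⟩
    spell (toℕ i) (later (ab i j ∷ ts))                          ∎
    where open ≡-Reasoning

  spell-injective : ∀ e es e′ es′ → spell e es ≡ spell e′ es′ → e ≡ e′ × es ≡ es′
  spell-injective (suc e) es (suc e′) es′ eq with spell-injective e es e′ es′ (∷-injectiveʳ eq)
  ... | e≡e′ , es≡es′ = cong suc e≡e′ , es≡es′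
  spell-injective zero [] zero [] _ = refl , refl
  spell-injective zero (f ∷ es) zero (f′ ∷ es′) eq with spell-injective f es f′ es′ (∷-injectiveʳ eq)
  ... | f≡f′ , es≡es′ = refl , cong₂ _∷_ f≡f′ es≡es′
  spell-injective zero    []      zero    (_ ∷ _) ()
  spell-injective zero    (_ ∷ _) zero    []      ()
  spell-injective zero    []      (suc _) _       ()
  spell-injective (suc _) _       zero    []      ()
  spell-injective zero    (_ ∷ _) (suc _) _       eq = ⊥-elim (a≢b (sym (∷-injectiveˡ eq)))
  spell-injective (suc _) _       zero    (_ ∷ _) eq = ⊥-elim (a≢b (∷-injectiveˡ eq))

  compose-true : ∀ {U Z : Sub n} {r i l j k} → U i j ≡ true → Z k l ≡ true → j ⊕ k ≡ r → compose n U r Z i l ≡ true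
  compose-true {U} {Z} {r} {i} {l} {j} {k} Uij Zkl j⊕k≡r = any-allFin _ j (any-allFin _ k
    (trans (cong₂ (λ x y → x ∧ y ∧ ⌊ (toℕ j + toℕ k) % n ℕ.≟ toℕ r ⌋) Uij Zkl)
           (Equivalence.to T-≡ (fromWitness {a? = (toℕ j + toℕ k) % n ℕ.≟ toℕ r} (trans (sym (toℕ-[] (toℕ j + toℕ k))) (cong toℕ j⊕k≡r))))))

  ≡-mod-n : ∀ t x t′ y → t * n + x ≡ t′ * n + y → [ x ] ≡ [ y ]
  ≡-mod-n t x t′ y eq = []-cong (begin
    x % n              ≡⟨ [m+kn]%n≡m%n x t n ⟨
    (x + t * n) % n    ≡⟨ cong (_% n) (trans (+-comm x (t * n)) (trans eq (+-comm (t′ * n) y))) ⟩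
    (y + t′ * n) % n   ≡⟨ [m+kn]%n≡m%n y t′ n ⟩
    y % n              ∎)
    where open ≡-Reasoning

  absorb-aⁿ : ∀ t x l → suc t * n + (x + l) ≡ t * n + (x + (n + l))
  absorb-aⁿ t x l = solve 4 (λ t x l m → (con 1 :+ t) :* m :+ (x :+ l) := t :* m :+ (x :+ (m :+ l))) refl t x l n

  module _ (Z : Sub n) (R : Sub n → Set) (Z∈R : R Z) (R-closed : ∀ {U} r → R U → R (compose n U r Z))
           (unambiguous : ∀ {U} → R U → ∀ {i j j′ k k′ l} → j ≢ j′ → U i j ≡ true → U i j′ ≡ true →
                          Z k l ≡ true → Z k′ l ≡ true → j ⊕ k ≡ j′ ⊕ k′ → ⊥) where

    -- Two parsings that split off a^i b a^j and a^i b a^j′ from the same word never meet again: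
    -- their next b's end compositions of U with Z over the same r, so equal exponents there
    -- contradict unambiguity and different ones give a diverging pair for compose n U r Z.
    no-resynchronisation : ∀ {U} → R U → ∀ {i j j′} → j ≢ j′ → U i j ≡ true → U i j′ ≡ true →
      ∀ t t′ ts ts′ → All (Valid Z) ts → All (Valid Z) ts′ →
      t * n + (toℕ j + lead ts) ≡ t′ * n + (toℕ j′ + lead ts′) → later ts ≡ later ts′ → ⊥
    no-resynchronisation U∈R j≢j′ Uij Uij′ t t′ (aⁿ ∷ ts) ts′ (_ ∷ vs) vs′ eq later≡ =
      no-resynchronisation U∈R j≢j′ Uij Uij′ (suc t) t′ ts ts′ vs vs′ (trans (absorb-aⁿ t _ (lead ts)) eq) later≡
    no-resynchronisation U∈R {j′ = j′} j≢j′ Uij Uij′ t t′ ts (aⁿ ∷ ts′) vs (_ ∷ vs′) eq later≡ =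
      no-resynchronisation U∈R j≢j′ Uij Uij′ t (suc t′) ts ts′ vs vs′ (trans eq (sym (absorb-aⁿ t′ (toℕ j′) (lead ts′)))) later≡
    no-resynchronisation U∈R {j = j} {j′} j≢j′ Uij Uij′ t t′ [] [] _ _ eq _ = j≢j′ (begin
      j                  ≡⟨ []-toℕ j ⟨
      [ toℕ j ]          ≡⟨ cong [_] (+-identityʳ (toℕ j)) ⟨
      [ toℕ j + 0 ]      ≡⟨ ≡-mod-n t (toℕ j + 0) t′ (toℕ j′ + 0) eq ⟩
      [ toℕ j′ + 0 ]     ≡⟨ cong [_] (+-identityʳ (toℕ j′)) ⟩
      [ toℕ j′ ]         ≡⟨ []-toℕ j′ ⟩
      j′                 ∎)
      where open ≡-Reasoning
    no-resynchronisation U∈R j≢j′ Uij Uij′ t t′ []            (ab _ _ ∷ _) _ _ _ ()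
    no-resynchronisation U∈R j≢j′ Uij Uij′ t t′ (ab _ _ ∷ _) []            _ _ _ ()
    no-resynchronisation {U} U∈R {i} {j} {j′} j≢j′ Uij Uij′ t t′
                         (ab i₂ j₂ ∷ ts) (ab i₂′ j₂′ ∷ ts′) (Zi₂j₂ ∷ vs) (Zi₂′j₂′ ∷ vs′) eq later≡
      with j₂ ≟ j₂′ | ≡-mod-n t (toℕ j + toℕ i₂) t′ (toℕ j′ + toℕ i₂′) eq
    ... | yes refl   | r≡ = unambiguous U∈R j≢j′ Uij Uij′ Zi₂j₂ Zi₂′j₂′ r≡
    ... | no j₂≢j₂′ | r≡ = no-resynchronisation (R-closed (j ⊕ i₂) U∈R) {i} {j₂} {j₂′} j₂≢j₂′
            (compose-true {U} {Z} Uij Zi₂j₂ refl) (compose-true {U} {Z} Uij′ Zi₂′j₂′ (sym r≡))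
            0 0 ts ts′ vs vs′ (∷-injectiveˡ later≡) (∷-injectiveʳ later≡)

    parse : ∀ ts ts′ → All (Valid Z) ts → All (Valid Z) ts′ → lead ts ≡ lead ts′ → later ts ≡ later ts′ → ts ≡ ts′
    parse []              []                _ _ _ _ = refl
    parse []              (aⁿ ∷ ts′)        _ _ lead≡ _ = ⊥-elim (≢-nonZero⁻¹ n (m+n≡0⇒m≡0 n (sym lead≡)))
    parse (aⁿ ∷ ts)       []                _ _ lead≡ _ = ⊥-elim (≢-nonZero⁻¹ n (m+n≡0⇒m≡0 n lead≡))
    parse []              (ab _ _ ∷ _)      _ _ _ ()
    parse (ab _ _ ∷ _)    []                _ _ _ ()
    parse (aⁿ ∷ ts)       (aⁿ ∷ ts′)        (_ ∷ vs) (_ ∷ vs′) lead≡ later≡ =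
      cong (aⁿ ∷_) (parse ts ts′ vs vs′ (+-cancelˡ-≡ n _ _ lead≡) later≡)
    parse (aⁿ ∷ ts)       (ab i′ j′ ∷ ts′)  _ _ lead≡ _ = ⊥-elim (<⇒≱ (Finₚ.toℕ<n i′) (subst (n ≤_) lead≡ (m≤m+n n (lead ts))))
    parse (ab i j ∷ ts)   (aⁿ ∷ ts′)        _ _ lead≡ _ = ⊥-elim (<⇒≱ (Finₚ.toℕ<n i) (subst (n ≤_) (sym lead≡) (m≤m+n n (lead ts′))))
    parse (ab i j ∷ ts)   (ab i′ j′ ∷ ts′)  (Zij ∷ vs) (Zi′j′ ∷ vs′) lead≡ later≡ with Finₚ.toℕ-injective lead≡ | j ≟ j′
    ... | refl | yes refl = cong (ab i j ∷_) (parse ts ts′ vs vs′ (+-cancelˡ-≡ (toℕ j) _ _ (∷-injectiveˡ later≡)) (∷-injectiveʳ later≡))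
    ... | refl | no j≢j′  =
      ⊥-elim (no-resynchronisation Z∈R j≢j′ Zij Zi′j′ 0 0 ts ts′ vs vs′ (∷-injectiveˡ later≡) (∷-injectiveʳ later≡))

    isCode : IsCode (withAn a b Z)
    isCode xs ys xs-valid ys-valid concat≡ with tokenize xs xs-valid | tokenize ys ys-valid
    ... | ts , ts-valid , refl | ts′ , ts′-valid , refl = cong (map word) (parse ts ts′ ts-valid ts′-valid (proj₁ spelled) (proj₂ spelled))
      where
      spelled : lead ts ≡ lead ts′ × later ts ≡ later ts′
      spelled = spell-injective _ _ _ _ (trans (sym (concat-words ts)) (trans concat≡ (concat-words ts′)))

module Conclusion {A : Set} (a b : A) (a≢b : a ≢ b) (n : ℕ) .{{_ : NonZero n}} (P Q : List ℤ)
                (|P|*|Q|≡n : length P * length Q ≡ n) where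
  open GroupSemiring n using (mass)
  open Histograms n
  open Matrices n
  open Indicators n
  open Bordering n (hist P) (hist Q)
  open RightDilation n (hist P) (hist Q)
  open Families n P Q
  open IntegerResidues n
  open Code a b a≢b n

  hPQ : mass (hist P) * mass (hist Q) ≡ n
  hPQ = trans (cong₂ _*_ (mass-hist P) (mass-hist Q)) |P|*|Q|≡n

  factors-positive : ∀ {x y} → x * y ≡ n → 1 ≤ x × 1 ≤ y
  factors-positive {zero}          x*y≡n = ⊥-elim (≢-nonZero⁻¹ n (sym x*y≡n))
  factors-positive {suc x} {zero}  x*y≡n = ⊥-elim (≢-nonZero⁻¹ n (trans (sym x*y≡n) (*-zeroʳ (suc x))))
  factors-positive {suc x} {suc y} _     = s≤s z≤n , s≤s z≤n

  mass-P≥1 : 1 ≤ mass (hist P)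
  mass-P≥1 = proj₁ (factors-positive {mass (hist P)} hPQ)

  mass-Q≥1 : 1 ≤ mass (hist Q)
  mass-Q≥1 = proj₂ (factors-positive {mass (hist P)} hPQ)

  good⇒compatible×borders : ∀ F → Good (Realised F) → Compatible a b n F × BordersFamily n P Q (StableOf n F)
  good⇒compatible×borders F F-good = compatible , λ Z Z∈F° → bordered⇒borders {Z} (stable-bordered Z∈F°)
    where
    open FromGood F F-good mass-P≥1 mass-Q≥1
    compatible : Compatible a b n F
    compatible Z Z∈F* = trans (card≡total Z) (bordered⇒total≡n hPQ (stable-bordered Z∈F°)) ,
                        isCode Z (StableOf n F) Z∈F° (λ r U∈F° → comp U∈F° r Z∈F°) (λ U∈F° → unambiguous U∈F° Z∈F°)
      where Z∈F° = compositions⊆stable Z∈F*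

  good-insert-phi : ∀ E → BordersFamily n P Q (StableOf n E) → ∀ {X} → E X → ∀ {d₁ d₂} →
                    Representative d₁ (length Q) → Representative d₂ (length P) → Good (Realised (insert (phi n d₁ d₂ X) E))
  good-insert-phi E E°-borders {X} X∈E {d₁} {d₂} R₁ R₂ = good-mono into good₂
    where
    open Representative R₁ renaming (D to D₁; D-nonZero to D₁≢0; coprime to D₁⊥Q; toℕ-D⊙ to toℕ-D₁⊙)
    open Representative R₂ renaming (D to D₂; D-nonZero to D₂≢0; coprime to D₂⊥P; toℕ-D⊙ to toℕ-D₂⊙)
    Y₁ Y₂ : Mat
    Y₁ = leftDil D₁ ⟦ X ⟧
    Y₂ = rightDil D₂ Y₁
    good₂ : Good (Realised E ∪≈ Y₁ ∪≈ Y₂)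
    good₂ = good-∪-rightDil hPQ D₂ {{D₂≢0}} (subst (Coprime D₂) (sym (mass-hist P)) D₂⊥P)
              (good-∪-leftDil hPQ D₁ {{D₁≢0}} (subst (Coprime D₁) (sym (mass-hist Q)) D₁⊥Q)
                (FromStable.good-realised E E°-borders hPQ) (X , X∈E , ≈-refl))
              (inj₂ ≈-refl)
    Y₂≈⟦φX⟧ : Y₂ ≈ ⟦ phi n d₁ d₂ X ⟧
    Y₂≈⟦φX⟧ = dil²≈⟦phi⟧ {d₁} {d₂} {D₁} {D₂} toℕ-D₁⊙ toℕ-D₂⊙ X
                (bordered⇒≤1 mass-P≥1 mass-Q≥1 {Y₂} (good₂ [ inj₂ ≈-refl ]))
    into : ∀ {M} → Realised (insert (phi n d₁ d₂ X) E) M → (Realised E ∪≈ Y₁ ∪≈ Y₂) M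
    into (Z , inj₁ refl , M≈⟦φX⟧) = inj₂ (≈-trans M≈⟦φX⟧ (≈-sym Y₂≈⟦φX⟧))
    into (Z , inj₂ Z∈E , M≈⟦Z⟧)   = inj₁ (inj₁ (Z , Z∈E , M≈⟦Z⟧))

mainTheorem4 : (A : Set) (a b : A) → a ≢ b →
    (n : ℕ) .{{_ : NonZero n}} → (E : Family n) → Compatible a b n E →
    (P Q : List ℤ) → Unique P → Unique Q →
    BordersFamily n P Q (StableOf n E) →
    (X : Sub n) → E X → (d₁ d₂ : ℤ) →
    Coprime ∣ d₁ ∣ (length Q) → Coprime ∣ d₂ ∣ (length P) →
    Compatible a b n (insert (phi n d₁ d₂ X) E)
      × BordersFamily n P Q (StableOf n (insert (phi n d₁ d₂ X) E))
mainTheorem4 A a b a≢b n E E-compatible P Q _ _ E°-borders X X∈E d₁ d₂ d₁⊥Q d₂⊥P =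
  good⇒compatible×borders (insert (phi n d₁ d₂ X) E)
    (good-insert-phi E E°-borders X∈E (representative d₁ |Q|∣n d₁⊥Q) (representative d₂ |P|∣n d₂⊥P))
  where
  open IntegerResidues n using (representative)
  |P|*|Q|≡n : length P * length Q ≡ n
  |P|*|Q|≡n = Families.borders⇒|P|*|Q|≡n n P Q (E°-borders X (base X∈E)) (proj₁ (E-compatible X (single X∈E)))
  open Conclusion a b a≢b n P Q |P|*|Q|≡n
  |Q|∣n : length Q ∣ n
  |Q|∣n = divides (length P) (sym |P|*|Q|≡n)
  |P|∣n : length P ∣ n
  |P|∣n = divides (length Q) (trans (sym |P|*|Q|≡n) (*-comm (length P) (length Q)))
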